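{- For every word $w$ (with at least two distinct letters) there exists a letter distribution $h_w$ with the following property: whenever $\delta\geq 0$ and $\Gamma$ is a one-dimensional grid satisfying $c_1(w,\Gamma)=C_1(w)(1-\delta)$, we have $\|h_\Gamma-h_w\|_{TV}\leq\delta$.
   Context: A word is a finite string $w=w_0\cdots w_{\ell-1}$ of letters. A one-dimensional grid of size $n$ is a map $\Gamma\colon\mathbb Z/n\mathbb Z\to\Sigma$ to an alphabet $\Sigma$. An appearance of $w$ in $\Gamma$ is a pair $(p,v)\in\mathbb Z/n\mathbb Z\times\{ -1,1\}$ with $\Gamma(p+iv)=w_i$ for $0\le i<\ell$; $c_1(w,\Gamma)$ is the number of appearances divided by $n$, and $C_1(w)$ is the supremum of $c_1(w,\Gamma)$ over all one-dimensional grids. A letter distribution is a function from letters to $[0,1]$; the letter distribution $h_\Gamma$ of $\Gamma$ is given by $h_\Gamma(A)=\frac1n|\{x:\Gamma(x)=A\}|$. The total variation distance is $\|h_1-h_2\|_{TV}=\frac12\sum_A|h_1(A)-h_2(A)|$, summing over all letters. -}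

module Defs where

open import Data.Nat as ℕ using (ℕ; zero; suc; _∸_)
open import Data.Nat.DivMod using (_%_; m%n<n)
open import Data.Fin as Fin using (Fin; toℕ; fromℕ<)
open import Data.Fin.Properties using (_≟_)
open import Data.List using (List; foldr; map; allFin; length; lookup)
open import Data.Bool using (Bool; true; false; if_then_else_; _∧_)
open import Data.Integer using (+_)
open import Data.Rational using (ℚ; _/_; _+_; _-_; _*_; ∣_∣; ½; 0ℚ; 1ℚ; _≤_; _<_)
open import Data.Product using (Σ; ∃; _×_; _,_)
open import Relation.Nullary using (¬_)
open import Relation.Nullary.Decidable using (⌊_⌋)
open import Relation.Binary.PropositionalEquality using (_≡_)

Word : ℕ → Set
Word k = List (Fin k)

-- A one-dimensional grid of size n = suc m (positions Fin n ≅ ℤ/nℤ).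
Grid : ℕ → ℕ → Set
Grid k n = Fin n → Fin k

HasTwoDistinctLetters : ∀ {k} → Word k → Set
HasTwoDistinctLetters w = ∃ λ i → ∃ λ j → ¬ (lookup w i ≡ lookup w j)

Σℚ : ∀ n → (Fin n → ℚ) → ℚ
Σℚ n f = foldr _+_ 0ℚ (map f (allFin n))

countFin : ∀ n → (Fin n → Bool) → ℕ
countFin n P = foldr (λ x acc → if P x then suc acc else acc) 0 (allFin n)

-- position p + i·v in ℤ/nℤ, for v = +1 (true) and v = -1 (false)
shift : ∀ {m} → Fin (suc m) → Bool → ℕ → Fin (suc m)
shift {m} p true  i = fromℕ< (m%n<n (toℕ p ℕ.+ i) (suc m))
shift {m} p false i = fromℕ< (m%n<n (toℕ p ℕ.+ (suc m ∸ (i % suc m))) (suc m))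

isAppearance : ∀ {k m} → Word k → Grid k (suc m) → Fin (suc m) → Bool → Bool
isAppearance w Γ p v =
  foldr _∧_ true (map (λ i → ⌊ Γ (shift p v (toℕ i)) ≟ lookup w i ⌋) (allFin (length w)))

appearances : ∀ {k m} → Word k → Grid k (suc m) → ℕ
appearances {m = m} w Γ =
  countFin (suc m) (λ p → isAppearance w Γ p true)
  ℕ.+ countFin (suc m) (λ p → isAppearance w Γ p false)

c₁ : ∀ {k m} → Word k → Grid k (suc m) → ℚ
c₁ {m = m} w Γ = (+ appearances w Γ) / suc m

hGrid : ∀ {k m} → Grid k (suc m) → Fin k → ℚ
hGrid {m = m} Γ A = (+ countFin (suc m) (λ x → ⌊ Γ x ≟ A ⌋)) / suc m

IsLetterDistribution : ∀ {k} → (Fin k → ℚ) → Set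
IsLetterDistribution h = ∀ A → (0ℚ ≤ h A) × (h A ≤ 1ℚ)

TV : ∀ {k} → (Fin k → ℚ) → (Fin k → ℚ) → ℚ
TV {k} h₁ h₂ = ½ * Σℚ k (λ A → ∣ h₁ A - h₂ A ∣)

-- "x ≤ y · C₁(w)" where C₁(w) = sup over all grids Γ' of c₁(w, Γ') (a real
-- number, not available in Agda).  For y > 0, y·sup = sup (y·c₁), and
-- x ≤ sup S  iff  every rational q < x is exceeded by some element of S.
-- For y ≤ 0, y·sup = inf (y·c₁)  (S is nonempty), and x ≤ inf iff x is a
-- lower bound.
LeScaledC₁ : ∀ {k} → Word k → (x y : ℚ) → Set
LeScaledC₁ {k} w x y =
  (0ℚ < y → ∀ q → q < x → Σ ℕ λ m → Σ (Grid k (suc m)) λ Γ' → q < y * c₁ w Γ')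
  × (y ≤ 0ℚ → ∀ m (Γ' : Grid k (suc m)) → x ≤ y * c₁ w Γ')

{-# OPTIONS --safe #-}
module Submission where

open import Defs
open import Data.Nat using (ℕ; suc)
open import Data.Fin using (Fin)
open import Data.Rational using (ℚ; _-_; 1ℚ)
open import Data.Product using (Σ; _×_)

open import Data.Bool.Base using (Bool; true; false; T; if_then_else_; _∧_; _∨_)
import Data.Bool.Properties as Bool
open import Data.Fin.Base as Fin using (toℕ; fromℕ<)
import Data.Fin.Properties as Finₚ
import Data.Integer.Base as ℤ
import Data.Integer.Properties as ℤₚ
open import Data.List.Base using (List; []; _∷_; length; lookup; foldr; tabulate)
open import Data.List.Properties using (map-tabulate)
open import Data.Nat.Base
open import Data.Nat.DivMod
open import Data.Nat.Induction using (<-rec)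
open import Data.Nat.Properties
open import Data.Nat.Tactic.RingSolver using (solve-∀)
open import Data.Product using (_,_; proj₁; proj₂)
import Data.Rational.Base as ℚ
import Data.Rational.Properties as ℚₚ
open import Data.Rational.Unnormalised.Base as ℚᵘ using (mkℚᵘ; *≡*; *≤*)
import Data.Rational.Unnormalised.Properties as ℚᵘₚ
open import Data.Sum.Base using (inj₁; inj₂)
open import Data.Unit.Base using (tt)
open import Relation.Binary.Definitions using (DecidableEquality)
open import Relation.Binary.PropositionalEquality hiding ([_])
open import Relation.Nullary using (Dec; yes; no; contradiction)
open import Relation.Nullary.Decidable using (map′; ⌊_⌋; toWitness; isYes≗does; dec-true)
open import Relation.Unary using (Decidable)
open import Algebra.Properties.Semiring.Sum +-*-semiring using (sum; sum-cong-≗; *-distribˡ-sum; *-distribʳ-sum)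
  renaming (∑-distrib-+ to sum-distrib-+; ∑-comm to sum-comm)

-- Write N(Γ) for the number of appearances of w in a grid Γ and #_A for the number of letters A.
-- Let p be the least period of w, d₁ the start of its longest palindromic suffix and
-- ℓ − d₂ the length of its longest proper palindromic prefix. Between two successive
-- appearances in a grid one reads, according to their directions, a full period of w,
-- the first d₁ letters of w, or the first d₂ letters of w reversed. Distributing these
-- letters over the appearances by a potential argument around the cyclic grid gives, for
-- every letter A, N(Γ)·T_A ≤ 2·#_A(Γ), where T_A is the smaller of 2·#_A w[0,p) and
-- #_A w[0,d₁) + #_A (rev w)[0,d₂). Which of the two is smaller does not depend on A, only
-- on whether 2p ≤ d₁ + d₂; accordingly the cyclic grid w[0,p) (at least one appearance)
-- or w[0,d₁)·(rev w)[0,d₂) (at least two) is a grid Γ* with N(Γ)·#_A(Γ*) ≤ N(Γ*)·#_A(Γ)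
-- for all Γ and A. Summed over A this says c₁(w,Γ) ≤ c₁(w,Γ*), so Γ* attains C₁(w); with
-- h_w = h_{Γ*} the two inequalities give c₁(w,Γ) ≤ c₁(w,Γ*)·Σ_A min(h_Γ(A), h_w(A)),
-- and Σ_A min(h_Γ(A), h_w(A)) = 1 − ‖h_Γ − h_w‖_TV.

x+[y+z]≡y+[x+z] : ∀ x y z → x + (y + z) ≡ y + (x + z)
x+[y+z]≡y+[x+z] = solve-∀

x+[y+z]≡x+z+y : ∀ x y z → x + (y + z) ≡ x + z + y
x+[y+z]≡x+z+y = solve-∀

x+y+z≡y+z+x : ∀ x y z → x + y + z ≡ y + z + x
x+y+z≡y+z+x = solve-∀

m+n≡o⇒o∸m≡n : ∀ {m n o} → m + n ≡ o → o ∸ m ≡ n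
m+n≡o⇒o∸m≡n {m} {n} refl = m+n∸m≡n m n

m+n+1≡o⇒m<o : ∀ {m n o} → m + n + 1 ≡ o → m < o
m+n+1≡o⇒m<o {m} {n} refl = subst (suc m ≤_) (sym (+-comm (m + n) 1)) (m≤m+n (suc m) n)

m+n<o⇒m<o∸n : ∀ {m n o} → m + n < o → m < o ∸ n
m+n<o⇒m<o∸n {m} {n} {o} lt = subst (_≤ o ∸ n) (m+n∸n≡m (suc m) n) (∸-monoˡ-≤ n lt)

m<o∸n⇒m+n<o : ∀ {m n o} → m < o ∸ n → m + n < o
m<o∸n⇒m+n<o {m} {n} {o} lt with n ≤? o
... | yes n≤o = subst (suc m + n ≤_) (m∸n+n≡m n≤o) (+-monoˡ-≤ n lt)
... | no n≰o  = contradiction (subst (m <_) (m≤n⇒m∸n≡0 (<⇒≤ (≰⇒> n≰o))) lt) λ ()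

[_] : Bool → ℕ
[ true ]  = 1
[ false ] = 0

record Least (P : ℕ → Set) : Set where
  field
    value   : ℕ
    holds   : P value
    minimal : ∀ {m} → P m → value ≤ m

least : {P : ℕ → Set} → Decidable P → ∀ {b} → P b → Least P
least {P} P? {b} = <-rec (λ b → P b → Least P) search b
  where
  search : ∀ b → (∀ {c} → c < b → P c → Least P) → P b → Least P
  search b smaller Pb with anyUpTo? P? b
  ... | yes (c , c<b , Pc) = smaller c<b Pc
  ... | no ∄c = record { value = b ; holds = Pb ; minimal = λ {m} Pm → ≮⇒≥ λ m<b → ∄c (m , m<b , Pm) }

-- Window sums

∑ : (ℕ → ℕ) → ℕ → ℕ → ℕ
∑ f a zero    = 0
∑ f a (suc m) = f a + ∑ f (suc a) m

∑-cong : ∀ {f g} a b m → (∀ i → i < m → f (a + i) ≡ g (b + i)) → ∑ f a m ≡ ∑ g b m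
∑-cong a b zero    eq = refl
∑-cong {f} {g} a b (suc m) eq = cong₂ _+_ head (∑-cong (suc a) (suc b) m tail)
  where
  head : f a ≡ g b
  head = subst₂ (λ x y → f x ≡ g y) (+-identityʳ a) (+-identityʳ b) (eq 0 z<s)
  tail : ∀ i → i < m → f (suc a + i) ≡ g (suc b + i)
  tail i i<m = subst₂ (λ x y → f x ≡ g y) (+-suc a i) (+-suc b i) (eq (suc i) (s<s i<m))

∑-++ : ∀ f a m k → ∑ f a (m + k) ≡ ∑ f a m + ∑ f (a + m) k
∑-++ f a zero    k = cong (λ x → ∑ f x k) (sym (+-identityʳ a))
∑-++ f a (suc m) k = begin
  f a + ∑ f (suc a) (m + k)                  ≡⟨ cong (f a +_) (∑-++ f (suc a) m k) ⟩
  f a + (∑ f (suc a) m + ∑ f (suc a + m) k)  ≡⟨ sym (+-assoc (f a) _ _) ⟩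
  f a + ∑ f (suc a) m + ∑ f (suc a + m) k    ≡⟨ cong (λ x → f a + ∑ f (suc a) m + ∑ f x k) (sym (+-suc a m)) ⟩
  f a + ∑ f (suc a) m + ∑ f (a + suc m) k    ∎
  where open ≡-Reasoning

∑-snoc : ∀ f a m → ∑ f a (suc m) ≡ ∑ f a m + f (a + m)
∑-snoc f a m = begin
  ∑ f a (suc m)                 ≡⟨ cong (∑ f a) (+-comm 1 m) ⟩
  ∑ f a (m + 1)                 ≡⟨ ∑-++ f a m 1 ⟩
  ∑ f a m + (f (a + m) + 0)     ≡⟨ cong (∑ f a m +_) (+-identityʳ _) ⟩
  ∑ f a m + f (a + m)           ∎
  where open ≡-Reasoning

∑-mono-length : ∀ f a {m k} → m ≤ k → ∑ f a m ≤ ∑ f a k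
∑-mono-length f a {m} {k} m≤k = begin
  ∑ f a m                              ≤⟨ m≤m+n _ _ ⟩
  ∑ f a m + ∑ f (a + m) (k ∸ m)        ≡⟨ ∑-++ f a m (k ∸ m) ⟨
  ∑ f a (m + (k ∸ m))                  ≡⟨ cong (∑ f a) (m+[n∸m]≡n m≤k) ⟩
  ∑ f a k                              ∎
  where open ≤-Reasoning

∑-subwindow : ∀ f a m b k → a ≤ b → b + k ≤ a + m → ∑ f b k ≤ ∑ f a m
∑-subwindow f a m b k a≤b b+k≤a+m = begin
  ∑ f b k                              ≡⟨ cong (λ x → ∑ f x k) (m+[n∸m]≡n a≤b) ⟨
  ∑ f (a + d) k                        ≤⟨ m≤n+m _ _ ⟩
  ∑ f a d + ∑ f (a + d) k              ≡⟨ ∑-++ f a d k ⟨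
  ∑ f a (d + k)                        ≤⟨ ∑-mono-length f a d+k≤m ⟩
  ∑ f a m                              ∎
  where
  open ≤-Reasoning
  d : ℕ
  d = b ∸ a
  d+k≤m : d + k ≤ m
  d+k≤m = +-cancelˡ-≤ a _ _ (subst (_≤ a + m) (trans (cong (_+ k) (sym (m+[n∸m]≡n a≤b))) (+-assoc a d k)) b+k≤a+m)

∑-point : ∀ f a {m x} → x < m → f (a + x) ≤ ∑ f a m
∑-point f a {m} {x} x<m = begin
  f (a + x)                ≡⟨ +-identityʳ _ ⟨
  ∑ f (a + x) 1            ≤⟨ ∑-subwindow f a m (a + x) 1 (m≤m+n a x) a+x+1≤a+m ⟩
  ∑ f a m                  ∎
  where
  open ≤-Reasoning
  a+x+1≤a+m : a + x + 1 ≤ a + m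
  a+x+1≤a+m = subst (_≤ a + m) (sym (trans (+-assoc a x 1) (cong (a +_) (+-comm x 1)))) (+-monoʳ-≤ a x<m)

∑-reverse : ∀ {f g} a b m → (∀ i j → i + j + 1 ≡ m → f (a + i) ≡ g (b + j)) → ∑ f a m ≡ ∑ g b m
∑-reverse a b zero eq = refl
∑-reverse {f} {g} a b (suc m) eq = begin
  f a + ∑ f (suc a) m         ≡⟨ cong (f a +_) (∑-reverse (suc a) b m inner) ⟩
  f a + ∑ g b m               ≡⟨ +-comm (f a) _ ⟩
  ∑ g b m + f a               ≡⟨ cong (∑ g b m +_) outer ⟩
  ∑ g b m + g (b + m)         ≡⟨ ∑-snoc g b m ⟨
  ∑ g b (suc m)               ∎
  where
  open ≡-Reasoning
  inner : ∀ i j → i + j + 1 ≡ m → f (suc a + i) ≡ g (b + j)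
  inner i j e = trans (cong f (sym (+-suc a i))) (eq (suc i) j (cong suc e))
  outer : f a ≡ g (b + m)
  outer = trans (cong f (sym (+-identityʳ a))) (eq 0 m (+-comm m 1))

∑-rotate : ∀ f n → (∀ x → f (x + n) ≡ f x) → ∀ c → ∑ f c n ≡ ∑ f 0 n
∑-rotate f n periodic zero    = refl
∑-rotate f n periodic (suc c) = trans (+-cancelˡ-≡ (f c) _ _ step) (∑-rotate f n periodic c)
  where
  step : f c + ∑ f (suc c) n ≡ f c + ∑ f c n
  step = begin
    f c + ∑ f (suc c) n     ≡⟨⟩
    ∑ f c (suc n)           ≡⟨ ∑-snoc f c n ⟩
    ∑ f c n + f (c + n)     ≡⟨ cong (∑ f c n +_) (periodic c) ⟩
    ∑ f c n + f c           ≡⟨ +-comm _ (f c) ⟩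
    f c + ∑ f c n           ∎
    where open ≡-Reasoning

∑-zero : ∀ f a m → (∀ i → i < m → f (a + i) ≡ 0) → ∑ f a m ≡ 0
∑-zero f a m eq = trans (∑-cong a 0 m eq) (zeros 0 m)
  where
  zeros : ∀ b m → ∑ (λ _ → 0) b m ≡ 0
  zeros b zero    = refl
  zeros b (suc m) = zeros (suc b) m

∑-distrib-+ : ∀ f g a m → ∑ (λ x → f x + g x) a m ≡ ∑ f a m + ∑ g a m
∑-distrib-+ f g a zero    = refl
∑-distrib-+ f g a (suc m) = trans (cong (f a + g a +_) (∑-distrib-+ f g (suc a) m)) (+-+-comm (f a) _ _ _)
  where
  +-+-comm : ∀ w x y z → w + x + (y + z) ≡ w + y + (x + z)
  +-+-comm = solve-∀

∑-distribʳ-* : ∀ f c a m → ∑ (λ x → f x * c) a m ≡ ∑ f a m * c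
∑-distribʳ-* f c a zero    = refl
∑-distribʳ-* f c a (suc m) = trans (cong (f a * c +_) (∑-distribʳ-* f c (suc a) m)) (sym (*-distribʳ-+ c (f a) _))

∑-telescope : ∀ (L R Φ : ℕ → ℕ) a m → (∀ b → a ≤ b → R b + Φ (suc b) ≤ L b + Φ b) →
              ∑ R a m + Φ (a + m) ≤ ∑ L a m + Φ a
∑-telescope L R Φ a zero    step = ≤-reflexive (cong Φ (+-identityʳ a))
∑-telescope L R Φ a (suc m) step = begin
  R a + ∑ R (suc a) m + Φ (a + suc m)      ≡⟨ cong (λ x → R a + ∑ R (suc a) m + Φ x) (+-suc a m) ⟩
  R a + ∑ R (suc a) m + Φ (suc a + m)      ≡⟨ +-assoc (R a) _ _ ⟩
  R a + (∑ R (suc a) m + Φ (suc a + m))    ≤⟨ +-monoʳ-≤ (R a) (∑-telescope L R Φ (suc a) m (λ b a<b → step b (<⇒≤ a<b))) ⟩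
  R a + (∑ L (suc a) m + Φ (suc a))        ≡⟨ x+[y+z]≡y+[x+z] (R a) (∑ L (suc a) m) (Φ (suc a)) ⟩
  ∑ L (suc a) m + (R a + Φ (suc a))        ≤⟨ +-monoʳ-≤ (∑ L (suc a) m) (step a ≤-refl) ⟩
  ∑ L (suc a) m + (L a + Φ a)              ≡⟨ x+[y+z]≡[y+x]+z (∑ L (suc a) m) (L a) (Φ a) ⟩
  L a + ∑ L (suc a) m + Φ a                ∎
  where
  open ≤-Reasoning
  x+[y+z]≡[y+x]+z : ∀ x y z → x + (y + z) ≡ y + x + z
  x+[y+z]≡[y+x]+z = solve-∀

-- Periods and palindromes

HasPeriod : {X : Set} → (ℕ → X) → ℕ → ℕ → Set
HasPeriod w ℓ q = ∀ i → i + q < ℓ → w i ≡ w (i + q)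

IsPalindrome : {X : Set} → (ℕ → X) → ℕ → ℕ → Set
IsPalindrome w a L = ∀ i j → i + j + 1 ≡ L → w (a + i) ≡ w (a + j)

reverse : {X : Set} → ℕ → (ℕ → X) → ℕ → X
reverse ℓ w i = w (ℓ ∸ suc i)

module _ {X Y : Set} (g : X → Y) {w : ℕ → X} where

  HasPeriod-map : ∀ {ℓ q} → HasPeriod w ℓ q → HasPeriod (λ i → g (w i)) ℓ q
  HasPeriod-map per i lt = cong g (per i lt)

  IsPalindrome-map : ∀ {a L} → IsPalindrome w a L → IsPalindrome (λ i → g (w i)) a L
  IsPalindrome-map pal i j e = cong g (pal i j e)

IsPalindrome-mirror : ∀ {X : Set} {w : ℕ → X} {a L} → IsPalindrome w a L → ∀ i → i < L → w (a + i) ≡ w (a + (L ∸ suc i))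
IsPalindrome-mirror {L = L} pal i i<L = pal i (L ∸ suc i) (trans (+-comm (i + (L ∸ suc i)) 1) (m+[n∸m]≡n i<L))

module _ {X : Set} (w : ℕ → X) where

  HasPeriod-trivial : ∀ {ℓ q} → ℓ ≤ q → HasPeriod w ℓ q
  HasPeriod-trivial {ℓ} {q} ℓ≤q i i+q<ℓ = contradiction (≤-trans ℓ≤q (m≤n+m q i)) (<⇒≱ i+q<ℓ)

  IsPalindrome-trivial : ∀ {a ℓ m} → ℓ ≤ m → IsPalindrome w a (ℓ ∸ m)
  IsPalindrome-trivial ℓ≤m i j e = contradiction (trans (+-comm 1 (i + j)) (trans e (m≤n⇒m∸n≡0 ℓ≤m))) λ ()

  module _ (_≟_ : DecidableEquality X) where

    hasPeriod? : ∀ ℓ q → Dec (HasPeriod w ℓ q)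
    hasPeriod? ℓ q = map′ (λ all i lt → all (m+n<o⇒m<o∸n lt)) (λ per {i} lt → per i (m<o∸n⇒m+n<o lt))
                          (allUpTo? (λ i → w i ≟ w (i + q)) (ℓ ∸ q))

    isPalindrome? : ∀ a L → Dec (IsPalindrome w a L)
    isPalindrome? a L = map′ to (λ pal {i} → IsPalindrome-mirror {w = w} pal i) (allUpTo? (λ i → w (a + i) ≟ w (a + (L ∸ suc i))) L)
      where
      to : (∀ {i} → i < L → w (a + i) ≡ w (a + (L ∸ suc i))) → IsPalindrome w a L
      to all i j e = trans (all (m+n+1≡o⇒m<o e)) (cong (λ z → w (a + z)) (m+n≡o⇒o∸m≡n (trans (sym (+-comm (i + j) 1)) e)))

module _ {X : Set} {w : ℕ → X} {ℓ : ℕ} where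

  palindromes⇒period : ∀ {d₁ d₂} → IsPalindrome w d₁ (ℓ ∸ d₁) → IsPalindrome w 0 (ℓ ∸ d₂) → HasPeriod w ℓ (d₁ + d₂)
  palindromes⇒period {d₁} {d₂} suffix prefix i lt with m≤n⇒∃[o]m+o≡n lt
  ... | k , e = begin
    w i                      ≡⟨ prefix (d₁ + k) i (sym (m+n≡o⇒o∸m≡n {d₂} (trans (rearrange₁ d₂ d₁ k i) e))) ⟨
    w (d₁ + k)               ≡⟨ suffix (d₂ + i) k (sym (m+n≡o⇒o∸m≡n {d₁} (trans (rearrange₂ d₁ d₂ i k) e))) ⟨
    w (d₁ + (d₂ + i))        ≡⟨ cong w (rearrange₃ d₁ d₂ i) ⟩
    w (i + (d₁ + d₂))        ∎
    where
    open ≡-Reasoning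
    rearrange₁ : ∀ d₂ d₁ k i → d₂ + (d₁ + k + i + 1) ≡ suc (i + (d₁ + d₂)) + k
    rearrange₁ = solve-∀
    rearrange₂ : ∀ d₁ d₂ i k → d₁ + (d₂ + i + k + 1) ≡ suc (i + (d₁ + d₂)) + k
    rearrange₂ = solve-∀
    rearrange₃ : ∀ d₁ d₂ i → d₁ + (d₂ + i) ≡ i + (d₁ + d₂)
    rearrange₃ = solve-∀

  HasPeriod-multiple : ∀ {D} → HasPeriod w ℓ D → ∀ r q → r + q * D < ℓ → w r ≡ w (r + q * D)
  HasPeriod-multiple per r zero    _  = cong w (sym (+-identityʳ r))
  HasPeriod-multiple {D} per r (suc q) lt = begin
    w r                  ≡⟨ HasPeriod-multiple per r q (≤-<-trans (+-monoʳ-≤ r (m≤n+m (q * D) D)) lt) ⟩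
    w (r + q * D)        ≡⟨ per (r + q * D) (subst (_< ℓ) (rearrange r D (q * D)) lt) ⟩
    w (r + q * D + D)    ≡⟨ cong w (rearrange r D (q * D)) ⟨
    w (r + (D + q * D))  ∎
    where
    open ≡-Reasoning
    rearrange : ∀ r D x → r + (D + x) ≡ r + x + D
    rearrange = solve-∀

  HasPeriod-mod : ∀ {D} .{{_ : NonZero D}} → HasPeriod w ℓ D → ∀ i → i < ℓ → w (i % D) ≡ w i
  HasPeriod-mod {D} per i i<ℓ = trans (HasPeriod-multiple per (i % D) (i / D) (subst (_< ℓ) i≡ i<ℓ)) (cong w (sym i≡))
    where
    i≡ : i ≡ i % D + i / D * D
    i≡ = m≡m%n+[m/n]*n i D

  suffix-reverse : ∀ {a} → IsPalindrome w a (ℓ ∸ a) → ∀ j → j < ℓ ∸ a → reverse ℓ w j ≡ w (a + j)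
  suffix-reverse {a} pal j j<L = sym (trans (IsPalindrome-mirror {w = w} pal j j<L) (cong w index))
    where
    a≤ℓ : a ≤ ℓ
    a≤ℓ = <⇒≤ (m∸n≢0⇒n<m λ e → contradiction (subst (suc j ≤_) e j<L) λ ())
    index : a + (ℓ ∸ a ∸ suc j) ≡ ℓ ∸ suc j
    index = trans (sym (+-∸-assoc a j<L)) (cong (_∸ suc j) (m+[n∸m]≡n a≤ℓ))

  prefix-reverse : ∀ {d} → IsPalindrome w 0 (ℓ ∸ d) → ∀ j → d ≤ j → j < ℓ → w (j ∸ d) ≡ reverse ℓ w j
  prefix-reverse {d} pal j d≤j j<ℓ = trans (IsPalindrome-mirror {w = w} pal (j ∸ d) (∸-monoˡ-< j<ℓ d≤j)) (cong w index)
    where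
    index : ℓ ∸ d ∸ suc (j ∸ d) ≡ ℓ ∸ suc j
    index = trans (∸-+-assoc ℓ d (suc (j ∸ d))) (cong (ℓ ∸_) (trans (+-suc d (j ∸ d)) (cong suc (m+[n∸m]≡n d≤j))))

_++⟨_⟩_ : {X : Set} → (ℕ → X) → ℕ → (ℕ → X) → ℕ → X
(u ++⟨ n ⟩ v) i = if ⌊ i <? n ⌋ then u i else v (i ∸ n)

module _ {X : Set} {u v : ℕ → X} {n : ℕ} where

  ++-left : ∀ {i} → i < n → (u ++⟨ n ⟩ v) i ≡ u i
  ++-left {i} i<n with i <? n
  ... | yes _  = refl
  ... | no i≮n = contradiction i<n i≮n

  ++-right : ∀ {i} → n ≤ i → (u ++⟨ n ⟩ v) i ≡ v (i ∸ n)
  ++-right {i} n≤i with i <? n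
  ... | yes i<n = contradiction n≤i (<⇒≱ i<n)
  ... | no _    = refl

  ∑-++⟨⟩ : ∀ (h : X → ℕ) m → ∑ (λ i → h ((u ++⟨ n ⟩ v) i)) 0 (n + m) ≡ ∑ (λ i → h (u i)) 0 n + ∑ (λ i → h (v i)) 0 m
  ∑-++⟨⟩ h m = trans (∑-++ _ 0 n m) (cong₂ _+_ (∑-cong 0 0 n λ i i<n → cong h (++-left i<n))
                                               (∑-cong n 0 m λ i _ → cong h (trans (++-right (m≤m+n n i)) (cong v (m+n∸m≡n n i)))))

module _ {f : ℕ → ℕ} where

  ∑-palindrome-mirror : ∀ {a L} → IsPalindrome f a L → ∀ i m j → i + m + j ≡ L → ∑ f (a + i) m ≡ ∑ f (a + j) m
  ∑-palindrome-mirror {a} pal i m j e = ∑-reverse (a + i) (a + j) m λ i′ j′ e′ →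
    trans (cong f (+-assoc a i i′)) (trans (pal (i + i′) (j + j′) (trans (rearrange i i′ j j′) (trans (cong (λ z → i + z + j) e′) e)))
      (cong f (sym (+-assoc a j j′))))
    where
    rearrange : ∀ i i′ j j′ → i + i′ + (j + j′) + 1 ≡ i + (i′ + j′ + 1) + j
    rearrange = solve-∀

module _ {f : ℕ → ℕ} {ℓ : ℕ} where

  ∑-period-window : ∀ {p} → HasPeriod f ℓ p → ∀ j → j + p ≤ ℓ → ∑ f j p ≡ ∑ f 0 p
  ∑-period-window         per zero    _       = refl
  ∑-period-window {p} per (suc j) j+p<ℓ = trans (+-cancelˡ-≡ (f j) _ _ step) (∑-period-window per j (<⇒≤ j+p<ℓ))
    where
    step : f j + ∑ f (suc j) p ≡ f j + ∑ f j p
    step = begin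
      ∑ f j (suc p)           ≡⟨ ∑-snoc f j p ⟩
      ∑ f j p + f (j + p)     ≡⟨ cong (∑ f j p +_) (per j j+p<ℓ) ⟨
      ∑ f j p + f j           ≡⟨ +-comm _ (f j) ⟩
      f j + ∑ f j p           ∎
      where open ≡-Reasoning

  ∑-shift-period : ∀ {p} → HasPeriod f ℓ p → ∀ x m → x + p + m ≤ ℓ → ∑ f (x + p) m ≡ ∑ f x m
  ∑-shift-period {p} per x m x+p+m≤ℓ = ∑-cong (x + p) x m λ i i<m →
    sym (trans (per (x + i) (lt i i<m)) (cong f (x+i+p≡x+p+i x i p)))
    where
    x+i+p≡x+p+i : ∀ x i p → x + i + p ≡ x + p + i
    x+i+p≡x+p+i = solve-∀
    lt : ∀ i → i < m → x + i + p < ℓ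
    lt i i<m = <-≤-trans (subst (_< x + p + m) (x+i+p≡x+p+i x p i) (+-monoʳ-< (x + p) i<m)) x+p+m≤ℓ

  ∑-reverse-window : ∀ a m b → a + m + b ≡ ℓ → ∑ (reverse ℓ f) a m ≡ ∑ f b m
  ∑-reverse-window a m b e = ∑-reverse a b m λ i j e′ →
    cong f (m+n≡o⇒o∸m≡n (trans (rearrange a i b j) (trans (cong (λ z → a + z + b) e′) e)))
    where
    rearrange : ∀ a i b j → suc (a + i) + (b + j) ≡ a + (i + j + 1) + b
    rearrange = solve-∀

-- Letter counts of a word

module LetterCounts (f : ℕ → ℕ) {ℓ p d₁ d₂ : ℕ} (p≤ℓ : p ≤ ℓ) (d₁≤ℓ : d₁ ≤ ℓ) (d₂≤ℓ : d₂ ≤ ℓ)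
  (period : HasPeriod f ℓ p) (suffix : IsPalindrome f d₁ (ℓ ∸ d₁)) (prefix : IsPalindrome f 0 (ℓ ∸ d₂))
  where

  open ≤-Reasoning

  periodCount headCount tailCount mixedCount : ℕ
  periodCount = ∑ f 0 p
  headCount   = ∑ f 0 d₁
  tailCount   = ∑ (reverse ℓ f) 0 d₂
  mixedCount  = headCount + tailCount

  private
    L₁ L₂ : ℕ
    L₁ = ℓ ∸ d₁
    L₂ = ℓ ∸ d₂

    d₁+L₁≡ℓ : d₁ + L₁ ≡ ℓ
    d₁+L₁≡ℓ = m+[n∸m]≡n d₁≤ℓ

    L₂+d₂≡ℓ : L₂ + d₂ ≡ ℓ
    L₂+d₂≡ℓ = m∸n+n≡m d₂≤ℓ

    F : ℕ → ℕ → ℕ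
    F = ∑ f
    R : ℕ → ℕ → ℕ
    R = ∑ (reverse ℓ f)

    R-suffix : ∀ m → m ≤ ℓ → R 0 m ≡ F (ℓ ∸ m) m
    R-suffix m m≤ℓ = ∑-reverse-window 0 m (ℓ ∸ m) (m+[n∸m]≡n m≤ℓ)

    R-prefix : R 0 d₂ ≡ F L₂ d₂
    R-prefix = ∑-reverse-window 0 d₂ L₂ (trans (+-comm d₂ L₂) L₂+d₂≡ℓ)

  reverse-periodCount : R 0 p ≡ periodCount
  reverse-periodCount = trans (R-suffix p p≤ℓ) (∑-period-window period (ℓ ∸ p) (≤-reflexive (m∸n+n≡m p≤ℓ)))

  private
    twice-period≤mixed-when-d₁<p : ∀ e b → p ≡ d₁ + e → p + e + b ≡ ℓ → p + e ≤ d₂ →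
                                  periodCount + periodCount ≤ mixedCount
    twice-period≤mixed-when-d₁<p e b p≡d₁+e p+e+b≡ℓ p+e≤d₂ = begin
      F 0 p + F 0 p                  ≡⟨ cong (λ z → F 0 z + F 0 p) p≡d₁+e ⟩
      F 0 (d₁ + e) + F 0 p           ≡⟨ cong (_+ F 0 p) (∑-++ f 0 d₁ e) ⟩
      F 0 d₁ + F d₁ e + F 0 p        ≡⟨ +-assoc (F 0 d₁) _ _ ⟩
      F 0 d₁ + (F d₁ e + F 0 p)      ≡⟨ cong (λ z → F 0 d₁ + (z + F 0 p)) middle ⟩
      F 0 d₁ + (R p e + F 0 p)       ≡⟨ cong (F 0 d₁ +_) (trans (+-comm _ (F 0 p)) (cong (_+ R p e) (sym reverse-periodCount))) ⟩
      F 0 d₁ + (R 0 p + R p e)       ≡⟨ cong (F 0 d₁ +_) (∑-++ (reverse ℓ f) 0 p e) ⟨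
      F 0 d₁ + R 0 (p + e)           ≤⟨ +-monoʳ-≤ (F 0 d₁) (∑-mono-length (reverse ℓ f) 0 p+e≤d₂) ⟩
      F 0 d₁ + R 0 d₂                ∎
      where
      L₁≡b+e+e+0 : b + e + e + 0 ≡ L₁
      L₁≡b+e+e+0 = +-cancelˡ-≡ d₁ _ _
        (trans (rearrange d₁ b e) (trans (cong (λ z → z + e + b) (sym p≡d₁+e)) (trans p+e+b≡ℓ (sym d₁+L₁≡ℓ))))
        where
        rearrange : ∀ d₁ b e → d₁ + (b + e + e + 0) ≡ d₁ + e + e + b
        rearrange = solve-∀
      middle : F d₁ e ≡ R p e
      middle = begin-equality
        F d₁ e               ≡⟨ cong (λ z → F z e) (+-identityʳ d₁) ⟨
        F (d₁ + 0) e         ≡⟨ ∑-palindrome-mirror suffix (b + e) e 0 L₁≡b+e+e+0 ⟨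
        F (d₁ + (b + e)) e   ≡⟨ cong (λ z → F z e) (trans (x+[y+z]≡y+[x+z] d₁ b e) (cong (b +_) (sym p≡d₁+e))) ⟩
        F (b + p) e          ≡⟨ ∑-shift-period period b e (≤-reflexive (trans (x+y+z≡y+z+x b p e) p+e+b≡ℓ)) ⟩
        F b e                ≡⟨ ∑-reverse-window p e b p+e+b≡ℓ ⟨
        R p e                ∎

    twice-period≤mixed-when-d₂<p : ∀ e j → p ≡ d₂ + e → L₂ ≡ j + e → p + e ≤ d₁ →
                                  periodCount + periodCount ≤ mixedCount
    twice-period≤mixed-when-d₂<p e j p≡d₂+e L₂≡j+e p+e≤d₁ = begin
      F 0 p + F 0 p                  ≡⟨ cong (F 0 p +_) middle ⟨
      F 0 p + (F 0 e + R 0 d₂)       ≡⟨ +-assoc (F 0 p) _ _ ⟨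
      F 0 p + F 0 e + R 0 d₂         ≡⟨ cong (λ z → F 0 p + z + R 0 d₂) (∑-shift-period period 0 e (≤-trans p+e≤d₁ d₁≤ℓ)) ⟨
      F 0 p + F p e + R 0 d₂         ≡⟨ cong (_+ R 0 d₂) (∑-++ f 0 p e) ⟨
      F 0 (p + e) + R 0 d₂           ≤⟨ +-monoˡ-≤ (R 0 d₂) (∑-mono-length f 0 p+e≤d₁) ⟩
      F 0 d₁ + R 0 d₂                ∎
      where
      middle : F 0 e + R 0 d₂ ≡ F 0 p
      middle = begin-equality
        F 0 e + R 0 d₂          ≡⟨ cong₂ _+_ (∑-palindrome-mirror prefix 0 e j (trans (+-comm e j) (sym L₂≡j+e))) R-prefix ⟩
        F j e + F L₂ d₂         ≡⟨ cong (λ z → F j e + F z d₂) L₂≡j+e ⟩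
        F j e + F (j + e) d₂    ≡⟨ ∑-++ f j e d₂ ⟨
        F j (e + d₂)            ≡⟨ cong (F j) (trans (+-comm e d₂) (sym p≡d₂+e)) ⟩
        F j p                   ≡⟨ ∑-period-window period j (≤-reflexive j+p≡ℓ) ⟩
        F 0 p                   ∎
        where
        j+p≡ℓ : j + p ≡ ℓ
        j+p≡ℓ = begin-equality
          j + p          ≡⟨ cong (j +_) (trans p≡d₂+e (+-comm d₂ e)) ⟩
          j + (e + d₂)   ≡⟨ +-assoc j e d₂ ⟨
          j + e + d₂     ≡⟨ cong (_+ d₂) L₂≡j+e ⟨
          L₂ + d₂        ≡⟨ L₂+d₂≡ℓ ⟩
          ℓ              ∎

    mixed≤twice-period-when-p<d₁ : ∀ e j → d₁ ≡ p + e → L₂ ≡ j + e → e + d₂ ≤ p →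
                                  mixedCount ≤ periodCount + periodCount
    mixed≤twice-period-when-p<d₁ e j d₁≡p+e L₂≡j+e e+d₂≤p = begin
      F 0 d₁ + R 0 d₂                ≡⟨ cong (λ z → F 0 z + R 0 d₂) d₁≡p+e ⟩
      F 0 (p + e) + R 0 d₂           ≡⟨ cong (_+ R 0 d₂) (∑-++ f 0 p e) ⟩
      F 0 p + F p e + R 0 d₂         ≡⟨ +-assoc (F 0 p) _ _ ⟩
      F 0 p + (F p e + R 0 d₂)       ≤⟨ +-monoʳ-≤ (F 0 p) middle ⟩
      F 0 p + F 0 p                  ∎
      where
      j+[e+d₂]≡ℓ : j + (e + d₂) ≡ ℓ
      j+[e+d₂]≡ℓ = trans (sym (+-assoc j e d₂)) (trans (cong (_+ d₂) (sym L₂≡j+e)) L₂+d₂≡ℓ)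
      middle : F p e + R 0 d₂ ≤ F 0 p
      middle = begin
        F p e + R 0 d₂
          ≡⟨ cong₂ _+_ (∑-shift-period period 0 e (≤-trans (≤-reflexive (sym d₁≡p+e)) d₁≤ℓ)) R-prefix ⟩
        F 0 e + F L₂ d₂
          ≡⟨ cong₂ _+_ (∑-palindrome-mirror prefix 0 e j (trans (+-comm e j) (sym L₂≡j+e))) (cong (λ z → F z d₂) L₂≡j+e) ⟩
        F j e + F (j + e) d₂     ≡⟨ ∑-++ f j e d₂ ⟨
        F j (e + d₂)
          ≤⟨ ∑-subwindow f (ℓ ∸ p) p j (e + d₂) ℓ∸p≤j (≤-reflexive (trans j+[e+d₂]≡ℓ (sym (m∸n+n≡m p≤ℓ)))) ⟩
        F (ℓ ∸ p) p              ≡⟨ ∑-period-window period (ℓ ∸ p) (≤-reflexive (m∸n+n≡m p≤ℓ)) ⟩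
        F 0 p                    ∎
        where
        ℓ∸p≤j : ℓ ∸ p ≤ j
        ℓ∸p≤j = subst (ℓ ∸ p ≤_) (m+n≡o⇒o∸m≡n (trans (+-comm (e + d₂) j) j+[e+d₂]≡ℓ)) (∸-monoʳ-≤ ℓ e+d₂≤p)

    mixed≤twice-period-when-p<d₂ : ∀ e i → d₂ ≡ p + e → L₁ ≡ i + e → d₁ + e ≤ p →
                                  mixedCount ≤ periodCount + periodCount
    mixed≤twice-period-when-p<d₂ e i d₂≡p+e L₁≡i+e d₁+e≤p = begin
      F 0 d₁ + R 0 d₂                ≡⟨ cong (λ z → F 0 d₁ + R 0 z) d₂≡p+e ⟩
      F 0 d₁ + R 0 (p + e)           ≡⟨ cong (F 0 d₁ +_) (∑-++ (reverse ℓ f) 0 p e) ⟩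
      F 0 d₁ + (R 0 p + R p e)       ≡⟨ cong (λ z → F 0 d₁ + (z + R p e)) reverse-periodCount ⟩
      F 0 d₁ + (F 0 p + R p e)       ≡⟨ cong (F 0 d₁ +_) (+-comm (F 0 p) _) ⟩
      F 0 d₁ + (R p e + F 0 p)       ≡⟨ +-assoc (F 0 d₁) _ _ ⟨
      F 0 d₁ + R p e + F 0 p         ≡⟨ cong (λ z → F 0 d₁ + z + F 0 p) middle ⟩
      F 0 d₁ + F d₁ e + F 0 p        ≡⟨ cong (_+ F 0 p) (∑-++ f 0 d₁ e) ⟨
      F 0 (d₁ + e) + F 0 p           ≤⟨ +-monoˡ-≤ (F 0 p) (∑-mono-length f 0 d₁+e≤p) ⟩
      F 0 p + F 0 p                  ∎
      where
      p+e+L₂≡ℓ : p + e + L₂ ≡ ℓ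
      p+e+L₂≡ℓ = trans (+-comm (p + e) L₂) (trans (cong (L₂ +_) (sym d₂≡p+e)) L₂+d₂≡ℓ)
      d₁+i≡L₂+p : d₁ + i ≡ L₂ + p
      d₁+i≡L₂+p = +-cancelʳ-≡ e _ _ (begin-equality
        d₁ + i + e       ≡⟨ +-assoc d₁ i e ⟩
        d₁ + (i + e)     ≡⟨ cong (d₁ +_) L₁≡i+e ⟨
        d₁ + L₁          ≡⟨ trans d₁+L₁≡ℓ (sym p+e+L₂≡ℓ) ⟩
        p + e + L₂       ≡⟨ x+y+z≡z+x+y p e L₂ ⟩
        L₂ + p + e       ∎)
        where
        x+y+z≡z+x+y : ∀ x y z → x + y + z ≡ z + x + y
        x+y+z≡z+x+y = solve-∀
      middle : R p e ≡ F d₁ e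
      middle = begin-equality
        R p e                ≡⟨ ∑-reverse-window p e L₂ p+e+L₂≡ℓ ⟩
        F L₂ e               ≡⟨ ∑-shift-period period L₂ e (≤-reflexive (trans (x+y+z≡y+z+x L₂ p e) p+e+L₂≡ℓ)) ⟨
        F (L₂ + p) e         ≡⟨ cong (λ z → F z e) d₁+i≡L₂+p ⟨
        F (d₁ + i) e         ≡⟨ ∑-palindrome-mirror suffix i e 0 (trans (+-identityʳ (i + e)) (sym L₁≡i+e)) ⟩
        F (d₁ + 0) e         ≡⟨ cong (λ z → F z e) (+-identityʳ d₁) ⟩
        F d₁ e               ∎

  twice-period≤mixed : p + p ≤ d₁ + d₂ → periodCount + periodCount ≤ mixedCount
  twice-period≤mixed 2p≤d₁+d₂ with p ≤? d₁ | p ≤? d₂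
  ... | yes p≤d₁ | yes p≤d₂ = +-mono-≤ (∑-mono-length f 0 p≤d₁)
                                        (≤-trans (≤-reflexive (sym reverse-periodCount)) (∑-mono-length (reverse ℓ f) 0 p≤d₂))
  ... | no p≰d₁ | _ = twice-period≤mixed-when-d₁<p e (ℓ ∸ (p + e)) p≡d₁+e (m+[n∸m]≡n (≤-trans p+e≤d₂ d₂≤ℓ)) p+e≤d₂
    where
    e : ℕ
    e = p ∸ d₁
    p≡d₁+e : p ≡ d₁ + e
    p≡d₁+e = sym (m+[n∸m]≡n (<⇒≤ (≰⇒> p≰d₁)))
    p+e≤d₂ : p + e ≤ d₂
    p+e≤d₂ = +-cancelˡ-≤ d₁ _ _ (subst (_≤ d₁ + d₂) (trans (cong (_+ p) p≡d₁+e) (x+y+z≡x+[z+y] d₁ e p)) 2p≤d₁+d₂)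
      where
      x+y+z≡x+[z+y] : ∀ x y z → x + y + z ≡ x + (z + y)
      x+y+z≡x+[z+y] = solve-∀
  ... | yes p≤d₁ | no p≰d₂ = twice-period≤mixed-when-d₂<p e (L₂ ∸ e) p≡d₂+e (sym (m∸n+n≡m e≤L₂)) p+e≤d₁
    where
    e : ℕ
    e = p ∸ d₂
    p≡d₂+e : p ≡ d₂ + e
    p≡d₂+e = sym (m+[n∸m]≡n (<⇒≤ (≰⇒> p≰d₂)))
    p+e≤d₁ : p + e ≤ d₁
    p+e≤d₁ = +-cancelʳ-≤ d₂ _ _ (subst (_≤ d₁ + d₂) (trans (cong (p +_) p≡d₂+e) (x+[y+z]≡x+z+y p d₂ e)) 2p≤d₁+d₂)
    e≤L₂ : e ≤ L₂
    e≤L₂ = +-cancelʳ-≤ d₂ _ _ (subst₂ _≤_ (trans p≡d₂+e (+-comm d₂ e)) (sym L₂+d₂≡ℓ) p≤ℓ)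

  mixed≤twice-period : d₁ + d₂ < p + p → mixedCount ≤ periodCount + periodCount
  mixed≤twice-period d₁+d₂<2p with d₁ ≤? p | d₂ ≤? p
  ... | yes d₁≤p | yes d₂≤p = +-mono-≤ (∑-mono-length f 0 d₁≤p)
                                        (≤-trans (∑-mono-length (reverse ℓ f) 0 d₂≤p) (≤-reflexive reverse-periodCount))
  ... | no d₁≰p | _ = mixed≤twice-period-when-p<d₁ e (L₂ ∸ e) d₁≡p+e (sym (m∸n+n≡m e≤L₂)) e+d₂≤p
    where
    e : ℕ
    e = d₁ ∸ p
    d₁≡p+e : d₁ ≡ p + e
    d₁≡p+e = sym (m+[n∸m]≡n (<⇒≤ (≰⇒> d₁≰p)))
    e+d₂≤p : e + d₂ ≤ p
    e+d₂≤p = <⇒≤ (+-cancelˡ-< p _ _ (subst (_< p + p) (trans (cong (_+ d₂) d₁≡p+e) (+-assoc p e d₂)) d₁+d₂<2p))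
    e≤L₂ : e ≤ L₂
    e≤L₂ = +-cancelʳ-≤ d₂ _ _ (≤-trans e+d₂≤p (subst (p ≤_) (sym L₂+d₂≡ℓ) p≤ℓ))
  ... | yes d₁≤p | no d₂≰p = mixed≤twice-period-when-p<d₂ e (L₁ ∸ e) d₂≡p+e (sym (m∸n+n≡m e≤L₁)) d₁+e≤p
    where
    e : ℕ
    e = d₂ ∸ p
    d₂≡p+e : d₂ ≡ p + e
    d₂≡p+e = sym (m+[n∸m]≡n (<⇒≤ (≰⇒> d₂≰p)))
    d₁+e≤p : d₁ + e ≤ p
    d₁+e≤p = <⇒≤ (+-cancelʳ-< p _ _ (subst (_< p + p) (trans (cong (d₁ +_) d₂≡p+e) (x+[y+z]≡x+z+y d₁ p e)) d₁+d₂<2p))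
    e≤L₁ : e ≤ L₁
    e≤L₁ = +-cancelˡ-≤ d₁ _ _ (≤-trans d₁+e≤p (subst (p ≤_) (sym d₁+L₁≡ℓ) p≤ℓ))

module WordStructure {X : Set} (_≟_ : DecidableEquality X) (w : ℕ → X) (last : ℕ) where

  ℓ : ℕ
  ℓ = suc last

  opaque
    leastPeriod : Least (λ q → HasPeriod w ℓ (suc q))
    leastPeriod = least (λ q → hasPeriod? w _≟_ ℓ (suc q)) (HasPeriod-trivial w ≤-refl)

    leastSuffix : Least (λ d → IsPalindrome w d (ℓ ∸ d))
    leastSuffix = least (λ d → isPalindrome? w _≟_ d (ℓ ∸ d)) (IsPalindrome-trivial w {ℓ} {ℓ} {ℓ} ≤-refl)

    leastPrefix : Least (λ q → IsPalindrome w 0 (ℓ ∸ suc q))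
    leastPrefix = least (λ q → isPalindrome? w _≟_ 0 (ℓ ∸ suc q)) {last} (IsPalindrome-trivial w {ℓ = ℓ} {suc last} ≤-refl)

  p⁻ d₁ d₂⁻ : ℕ
  p⁻  = Least.value leastPeriod
  d₁  = Least.value leastSuffix
  d₂⁻ = Least.value leastPrefix

  p d₂ : ℕ
  p  = suc p⁻
  d₂ = suc d₂⁻

  period : HasPeriod w ℓ p
  period = Least.holds leastPeriod

  period-minimal : ∀ {q} → HasPeriod w ℓ (suc q) → p ≤ suc q
  period-minimal per = s≤s (Least.minimal leastPeriod per)

  suffix : IsPalindrome w d₁ (ℓ ∸ d₁)
  suffix = Least.holds leastSuffix

  suffix-minimal : ∀ {d} → IsPalindrome w d (ℓ ∸ d) → d₁ ≤ d
  suffix-minimal = Least.minimal leastSuffix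

  prefix : IsPalindrome w 0 (ℓ ∸ d₂)
  prefix = Least.holds leastPrefix

  prefix-minimal : ∀ {q} → IsPalindrome w 0 (ℓ ∸ suc q) → d₂ ≤ suc q
  prefix-minimal pal = s≤s (Least.minimal leastPrefix pal)

  p≤ℓ : p ≤ ℓ
  p≤ℓ = period-minimal (HasPeriod-trivial w ≤-refl)

  d₁≤ℓ : d₁ ≤ ℓ
  d₁≤ℓ = suffix-minimal (IsPalindrome-trivial w {ℓ} {ℓ} {ℓ} ≤-refl)

  d₂≤ℓ : d₂ ≤ ℓ
  d₂≤ℓ = prefix-minimal {last} (IsPalindrome-trivial w {ℓ = ℓ} {suc last} ≤-refl)

  δ : X → X → ℕ
  δ A x = [ ⌊ x ≟ A ⌋ ]

  module ForLetter (A : X) where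

    f : ℕ → ℕ
    f i = δ A (w i)

    open LetterCounts f p≤ℓ d₁≤ℓ d₂≤ℓ (HasPeriod-map (δ A) period) (IsPalindrome-map (δ A) {w} suffix)
                                    (IsPalindrome-map (δ A) {w} prefix) public

-- Amortisation around a cycle

module CyclicAmortisation (occ : ℕ → Bool) (R L γ : ℕ → ℕ) (n : ℕ)
  (R-off : ∀ x → occ x ≡ false → R x ≡ 0)
  (step : ∀ y g → 1 ≤ g → occ y ≡ true → occ (y + g) ≡ true → R (y + g) + γ (y + g) ≤ ∑ L y g + γ y)
  (occ-periodic : ∀ x → occ (x + n) ≡ occ x) (R-periodic : ∀ x → R (x + n) ≡ R x)
  (L-periodic : ∀ x → L (x + n) ≡ L x) (γ-periodic : ∀ x → γ (x + n) ≡ γ x)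
  where

  module FromOccurrence (s : ℕ) (occ-s : occ s ≡ true) where

    lastOcc : ℕ → ℕ
    lastOcc zero    = s
    lastOcc (suc b) = if occ b then b else lastOcc b

    lastOcc-spec : ∀ b → s < b → lastOcc b < b × occ (lastOcc b) ≡ true
    lastOcc-spec (suc b) s≤b with occ b in occ-b
    ... | true  = ≤-refl , occ-b
    ... | false with m≤n⇒m<n∨m≡n (s≤s⁻¹ s≤b)
    ...   | inj₁ s<b  = let lt , o = lastOcc-spec b s<b in m≤n⇒m≤1+n lt , o
    ...   | inj₂ refl = contradiction (trans (sym occ-s) occ-b) λ ()

    open ≤-Reasoning

    Φ : ℕ → ℕ
    Φ b = ∑ L (lastOcc b) (b ∸ lastOcc b) + γ (lastOcc b)

    Φ-after-occurrence : ∀ b → occ b ≡ true → Φ (suc b) ≡ L b + γ b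
    Φ-after-occurrence b occ-b rewrite occ-b =
      trans (cong (λ z → ∑ L b z + γ b) (trans (+-∸-assoc 1 (≤-refl {b})) (cong suc (n∸n≡0 b))))
            (cong (_+ γ b) (+-identityʳ (L b)))

    lastOcc-skip : ∀ b → occ b ≡ false → lastOcc (suc b) ≡ lastOcc b
    lastOcc-skip b occ-b rewrite occ-b = refl

    potential-step : ∀ b → suc s ≤ b → R b + Φ (suc b) ≤ L b + Φ b
    potential-step b s<b = by-cases (occ b) refl
      where
      t : ℕ
      t = lastOcc b
      g : ℕ
      g = b ∸ t
      t<b : t < b
      t<b = proj₁ (lastOcc-spec b s<b)
      t+g≡b : t + g ≡ b
      t+g≡b = m+[n∸m]≡n (<⇒≤ t<b)
      by-cases : ∀ c → occ b ≡ c → R b + Φ (suc b) ≤ L b + Φ b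
      by-cases false occ-b = ≤-reflexive (begin-equality
        R b + Φ (suc b)
          ≡⟨ cong₂ _+_ (R-off b occ-b) (cong (λ u → ∑ L u (suc b ∸ u) + γ u) (lastOcc-skip b occ-b)) ⟩
        ∑ L t (suc b ∸ t) + γ t                ≡⟨ cong (λ z → ∑ L t z + γ t) (+-∸-assoc 1 (<⇒≤ t<b)) ⟩
        ∑ L t (suc g) + γ t                    ≡⟨ cong (_+ γ t) (∑-snoc L t g) ⟩
        ∑ L t g + L (t + g) + γ t              ≡⟨ cong (λ z → ∑ L t g + L z + γ t) t+g≡b ⟩
        ∑ L t g + L b + γ t                    ≡⟨ x+y+z≡y+[x+z] (∑ L t g) (L b) (γ t) ⟩
        L b + Φ b                              ∎)
        where
        x+y+z≡y+[x+z] : ∀ x y z → x + y + z ≡ y + (x + z)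
        x+y+z≡y+[x+z] = solve-∀
      by-cases true occ-b = begin
        R b + Φ (suc b)                        ≡⟨ cong (R b +_) (Φ-after-occurrence b occ-b) ⟩
        R b + (L b + γ b)                      ≡⟨ x+[y+z]≡y+[x+z] (R b) (L b) (γ b) ⟩
        L b + (R b + γ b)                      ≡⟨ cong (λ z → L b + (R z + γ z)) t+g≡b ⟨
        L b + (R (t + g) + γ (t + g))
          ≤⟨ +-monoʳ-≤ (L b) (step t g (m<n⇒0<n∸m t<b) (proj₂ (lastOcc-spec b s<b)) (trans (cong occ t+g≡b) occ-b)) ⟩
        L b + Φ b                              ∎

    one-period : ∑ R 0 n ≤ ∑ L 0 n
    one-period = begin
      ∑ R 0 n          ≡⟨ ∑-rotate R n R-periodic (suc s) ⟨
      ∑ R (suc s) n    ≤⟨ +-cancelʳ-≤ (L s + γ s) _ _ telescoped ⟩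
      ∑ L (suc s) n    ≡⟨ ∑-rotate L n L-periodic (suc s) ⟩
      ∑ L 0 n          ∎
      where
      wrap : Φ (suc s + n) ≡ L s + γ s
      wrap = trans (Φ-after-occurrence (s + n) (trans (occ-periodic s) occ-s)) (cong₂ _+_ (L-periodic s) (γ-periodic s))
      telescoped : ∑ R (suc s) n + (L s + γ s) ≤ ∑ L (suc s) n + (L s + γ s)
      telescoped = subst₂ (λ x y → ∑ R (suc s) n + x ≤ ∑ L (suc s) n + y) wrap (Φ-after-occurrence s occ-s)
                          (∑-telescope L R Φ (suc s) n potential-step)

  ∑R≤∑L : ∑ R 0 n ≤ ∑ L 0 n
  ∑R≤∑L with anyUpTo? (λ x → occ x Bool.≟ true) n
  ... | yes (s , _ , occ-s) = FromOccurrence.one-period s occ-s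
  ... | no none = subst (_≤ ∑ L 0 n) (sym (∑-zero R 0 n λ i i<n → R-off i (Bool.¬-not λ o → none (i , i<n , o)))) z≤n

-- Gaps between appearances

module Occurrences {X : Set} (_≟_ : DecidableEquality X) (w : ℕ → X) (last : ℕ)
  (G : ℕ → X) (fwd bwd : ℕ → Bool)
  (fwd-spec : ∀ x → fwd x ≡ true → ∀ i → i < suc last → G (x + i) ≡ w i)
  (bwd-spec : ∀ x → bwd x ≡ true → ∀ i → i < suc last → G (x + i) ≡ reverse (suc last) w i)
  where

  open WordStructure _≟_ w last

  private
    <ℓ : ∀ {a b} → a + b ≡ last → a < ℓ
    <ℓ {a} {b} e = s≤s (subst (a ≤_) e (m≤m+n a b))

    window-sum : ∀ g i j → i + j + 1 ≡ ℓ ∸ g → g + i + j ≡ last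
    window-sum g i j e with g ≤? ℓ
    ... | yes g≤ℓ = suc-injective (trans (rearrange g i j) (trans (cong (g +_) e) (m+[n∸m]≡n g≤ℓ)))
      where
      rearrange : ∀ g i j → suc (g + i + j) ≡ g + (i + j + 1)
      rearrange = solve-∀
    ... | no g≰ℓ = contradiction (trans (+-comm 1 (i + j)) (trans e (m≤n⇒m∸n≡0 (<⇒≤ (≰⇒> g≰ℓ))))) (λ ())

  fwd-fwd⇒period : ∀ y g → fwd y ≡ true → fwd (y + g) ≡ true → HasPeriod w ℓ g
  fwd-fwd⇒period y g fy fz i i+g<ℓ = begin
    w i                ≡⟨ fwd-spec (y + g) fz i (≤-<-trans (m≤m+n i g) i+g<ℓ) ⟨
    G (y + g + i)      ≡⟨ cong G (rearrange y g i) ⟩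
    G (y + (i + g))    ≡⟨ fwd-spec y fy (i + g) i+g<ℓ ⟩
    w (i + g)          ∎
    where
    open ≡-Reasoning
    rearrange : ∀ y g i → y + g + i ≡ y + (i + g)
    rearrange = solve-∀

  bwd-bwd⇒period : ∀ y g → bwd y ≡ true → bwd (y + g) ≡ true → HasPeriod w ℓ g
  bwd-bwd⇒period y g by bz i i+g<ℓ with m≤n⇒∃[o]m+o≡n (s≤s⁻¹ i+g<ℓ)
  ... | k , i+g+k≡last = begin
    w i                      ≡⟨ cong w (m+n≡o⇒o∸m≡n (trans (rearrange₁ k g i) i+g+k≡last)) ⟨
    w (last ∸ (k + g))       ≡⟨ bwd-spec y by (k + g) (<ℓ (trans (rearrange₁ k g i) i+g+k≡last)) ⟨
    G (y + (k + g))          ≡⟨ cong G (rearrange₂ y k g) ⟩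
    G (y + g + k)            ≡⟨ bwd-spec (y + g) bz k (<ℓ (trans (+-comm k (i + g)) i+g+k≡last)) ⟩
    w (last ∸ k)             ≡⟨ cong w (m+n≡o⇒o∸m≡n {k} (trans (+-comm k (i + g)) i+g+k≡last)) ⟩
    w (i + g)                ∎
    where
    open ≡-Reasoning
    rearrange₁ : ∀ k g i → k + g + i ≡ i + g + k
    rearrange₁ = solve-∀
    rearrange₂ : ∀ y k g → y + (k + g) ≡ y + g + k
    rearrange₂ = solve-∀

  fwd-bwd⇒suffix : ∀ y g → fwd y ≡ true → bwd (y + g) ≡ true → IsPalindrome w g (ℓ ∸ g)
  fwd-bwd⇒suffix y g fy bz i j e = begin
    w (g + i)            ≡⟨ fwd-spec y fy (g + i) (<ℓ (window-sum g i j e)) ⟨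
    G (y + (g + i))      ≡⟨ cong G (sym (+-assoc y g i)) ⟩
    G (y + g + i)        ≡⟨ bwd-spec (y + g) bz i (<ℓ (trans (rearrange i g j) (window-sum g i j e))) ⟩
    w (last ∸ i)         ≡⟨ cong w (m+n≡o⇒o∸m≡n {i} (trans (rearrange i g j) (window-sum g i j e))) ⟩
    w (g + j)            ∎
    where
    open ≡-Reasoning
    rearrange : ∀ i g j → i + (g + j) ≡ g + i + j
    rearrange = solve-∀

  bwd-fwd⇒prefix : ∀ y g → bwd y ≡ true → fwd (y + g) ≡ true → IsPalindrome w 0 (ℓ ∸ g)
  bwd-fwd⇒prefix y g by fz i j e = begin
    w i                  ≡⟨ fwd-spec (y + g) fz i (<ℓ (trans (rearrange i g j) (window-sum g i j e))) ⟨
    G (y + g + i)        ≡⟨ cong G (+-assoc y g i) ⟩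
    G (y + (g + i))      ≡⟨ bwd-spec y by (g + i) (<ℓ (window-sum g i j e)) ⟩
    w (last ∸ (g + i))   ≡⟨ cong w (m+n≡o⇒o∸m≡n (window-sum g i j e)) ⟩
    w j                  ∎
    where
    open ≡-Reasoning
    rearrange : ∀ i g j → i + (g + j) ≡ g + i + j
    rearrange = solve-∀

  fwd-bwd⇒d₁≡0 : ∀ y → fwd y ≡ true → bwd y ≡ true → d₁ ≡ 0
  fwd-bwd⇒d₁≡0 y fy by = n≤0⇒n≡0 (suffix-minimal (fwd-bwd⇒suffix y 0 fy (subst (λ z → bwd z ≡ true) (sym (+-identityʳ y)) by)))

  occ : ℕ → Bool
  occ x = fwd x ∨ bwd x

  starts : ℕ → ℕ
  starts x = [ fwd x ] + [ bwd x ]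

  module GapCounts (A : X) where

    open ForLetter A public

    g : ℕ → ℕ
    g x = δ A (G x)

    fwd-window : ∀ y {m} → fwd y ≡ true → m ≤ ℓ → ∑ g y m ≡ ∑ f 0 m
    fwd-window y {m} fy m≤ℓ = ∑-cong y 0 m λ i i<m → cong (δ A) (fwd-spec y fy i (<-≤-trans i<m m≤ℓ))

    bwd-window : ∀ y {m} → bwd y ≡ true → m ≤ ℓ → ∑ g y m ≡ ∑ (reverse ℓ f) 0 m
    bwd-window y {m} by m≤ℓ = ∑-cong y 0 m λ i i<m → cong (δ A) (bwd-spec y by i (<-≤-trans i<m m≤ℓ))

    private
      window≤gap : ∀ y {q c} gap → ∑ g y q ≡ c → q ≤ gap → c ≤ ∑ g y gap
      window≤gap y gap refl q≤gap = ∑-mono-length g y q≤gap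

    gap-fwd-fwd : ∀ y gap → fwd y ≡ true → fwd (y + suc gap) ≡ true → periodCount ≤ ∑ g y (suc gap)
    gap-fwd-fwd y gap fy fz = window≤gap y (suc gap) (fwd-window y fy p≤ℓ) (period-minimal (fwd-fwd⇒period y (suc gap) fy fz))

    gap-bwd-bwd : ∀ y gap → bwd y ≡ true → bwd (y + suc gap) ≡ true → periodCount ≤ ∑ g y (suc gap)
    gap-bwd-bwd y gap by bz = window≤gap y (suc gap) (trans (bwd-window y by p≤ℓ) reverse-periodCount)
                                         (period-minimal (bwd-bwd⇒period y (suc gap) by bz))

    gap-fwd-bwd : ∀ y gap → fwd y ≡ true → bwd (y + gap) ≡ true → headCount ≤ ∑ g y gap
    gap-fwd-bwd y gap fy bz = window≤gap y gap (fwd-window y fy d₁≤ℓ) (suffix-minimal (fwd-bwd⇒suffix y gap fy bz))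

    gap-bwd-fwd : ∀ y gap → bwd y ≡ true → fwd (y + suc gap) ≡ true → tailCount ≤ ∑ g y (suc gap)
    gap-bwd-fwd y gap by fz = window≤gap y (suc gap) (bwd-window y by d₂≤ℓ) (prefix-minimal (bwd-fwd⇒prefix y (suc gap) by fz))

    module Threshold (T : ℕ) (T≤2·period : T ≤ periodCount + periodCount) (T≤mixed : T ≤ mixedCount) where

      -- Every appearance pays T; a backward one also keeps 2·headCount in reserve, since the
      -- gap from it to a following forward appearance is only guaranteed tailCount letters A.
      γ : ℕ → ℕ
      γ x = if bwd x then headCount + headCount else T

      arrivalCost : Bool → ℕ
      arrivalCost true  = T + T
      arrivalCost false = T + (headCount + headCount)

      arrival : ∀ z → starts z * T + γ z ≤ arrivalCost (fwd z)
      arrival z with fwd z in fz | bwd z in bz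
      ... | true  | true  = ≤-reflexive (trans (cong (λ c → T + (T + 0) + (c + c)) headCount≡0) (rearrange T))
        where
        headCount≡0 : headCount ≡ 0
        headCount≡0 = cong (∑ f 0) (fwd-bwd⇒d₁≡0 z fz bz)
        rearrange : ∀ T → T + (T + 0) + (0 + 0) ≡ T + T
        rearrange = solve-∀
      ... | true  | false = ≤-reflexive (cong (_+ T) (+-identityʳ T))
      ... | false | true  = ≤-reflexive (cong (_+ (headCount + headCount)) (+-identityʳ T))
      ... | false | false = m≤m+n T (headCount + headCount)

      departure : ∀ y gap → occ y ≡ true → occ (y + suc gap) ≡ true →
                  arrivalCost (fwd (y + suc gap)) ≤ ∑ g y (suc gap) + ∑ g y (suc gap) + γ y
      departure y gap oy oz with bwd y in by | fwd (y + suc gap) in fz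
      ... | true  | true  = begin
        T + T                         ≤⟨ +-mono-≤ T≤mixed T≤mixed ⟩
        mixedCount + mixedCount       ≤⟨ +-mono-≤ mixed≤headCount+C mixed≤headCount+C ⟩
        (headCount + C) + (headCount + C)           ≡⟨ rearrange headCount C ⟩
        C + C + (headCount + headCount)             ∎
        where
        open ≤-Reasoning
        C : ℕ
        C = ∑ g y (suc gap)
        mixed≤headCount+C : mixedCount ≤ headCount + C
        mixed≤headCount+C = +-monoʳ-≤ headCount (gap-bwd-fwd y gap by fz)
        rearrange : ∀ c C → c + C + (c + C) ≡ C + C + (c + c)
        rearrange = solve-∀
      ... | false | true  = +-monoˡ-≤ T (≤-trans T≤2·period (+-mono-≤ P≤C P≤C))
        where
        P≤C : periodCount ≤ ∑ g y (suc gap)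
        P≤C = gap-fwd-fwd y gap (trans (sym (Bool.∨-identityʳ (fwd y))) oy) fz
      ... | true  | false = +-monoˡ-≤ (headCount + headCount) (≤-trans T≤2·period (+-mono-≤ P≤C P≤C))
        where
        P≤C : periodCount ≤ ∑ g y (suc gap)
        P≤C = gap-bwd-bwd y gap by oz
      ... | false | false = subst (_≤ ∑ g y (suc gap) + ∑ g y (suc gap) + T) (+-comm (headCount + headCount) T)
                                  (+-monoˡ-≤ T (+-mono-≤ headCount≤C headCount≤C))
        where
        headCount≤C : headCount ≤ ∑ g y (suc gap)
        headCount≤C = gap-fwd-bwd y (suc gap) (trans (sym (Bool.∨-identityʳ (fwd y))) oy) oz

      step : ∀ y gap → 1 ≤ gap → occ y ≡ true → occ (y + gap) ≡ true →
             starts (y + gap) * T + γ (y + gap) ≤ ∑ (λ x → g x + g x) y gap + γ y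
      step y (suc gap) _ oy oz = begin
        starts z * T + γ z                         ≤⟨ arrival z ⟩
        arrivalCost (fwd z)                        ≤⟨ departure y gap oy oz ⟩
        ∑ g y (suc gap) + ∑ g y (suc gap) + γ y    ≡⟨ cong (_+ γ y) (∑-distrib-+ g g y (suc gap)) ⟨
        ∑ (λ x → g x + g x) y (suc gap) + γ y      ∎
        where
        open ≤-Reasoning
        z : ℕ
        z = y + suc gap

      weighted-bound : ∀ n → (∀ x → G (x + n) ≡ G x) → (∀ x → fwd (x + n) ≡ fwd x) → (∀ x → bwd (x + n) ≡ bwd x) →
                       ∑ starts 0 n * T ≤ ∑ g 0 n + ∑ g 0 n
      weighted-bound n G-periodic fwd-periodic bwd-periodic =
        subst₂ _≤_ (∑-distribʳ-* starts T 0 n) (∑-distrib-+ g g 0 n) Amortised.∑R≤∑L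
        where
        R-off : ∀ x → occ x ≡ false → starts x * T ≡ 0
        R-off x no-occ = cong₂ (λ a b → ([ a ] + [ b ]) * T) (Bool.∨-conicalˡ (fwd x) (bwd x) no-occ) (Bool.∨-conicalʳ (fwd x) (bwd x) no-occ)
        module Amortised = CyclicAmortisation occ (λ x → starts x * T) (λ x → g x + g x) γ n R-off step
          (λ x → cong₂ _∨_ (fwd-periodic x) (bwd-periodic x))
          (λ x → cong₂ (λ a b → ([ a ] + [ b ]) * T) (fwd-periodic x) (bwd-periodic x))
          (λ x → cong₂ _+_ (cong (δ A) (G-periodic x)) (cong (δ A) (G-periodic x)))
          (λ x → cong (λ b → if b then headCount + headCount else T) (bwd-periodic x))

-- Grids as periodic sequences

-- Past the end of the word this repeats its last letter; only positions below its length matter.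
wordAt : ∀ {k} → Fin k → List (Fin k) → ℕ → Fin k
wordAt a rest       zero    = a
wordAt a []         (suc i) = a
wordAt a (b ∷ rest) (suc i) = wordAt b rest i

lookup-wordAt : ∀ {k} (a : Fin k) rest (i : Fin (suc (length rest))) → lookup (a ∷ rest) i ≡ wordAt a rest (toℕ i)
lookup-wordAt a rest       Fin.zero    = refl
lookup-wordAt a (b ∷ rest) (Fin.suc i) = lookup-wordAt b rest i

and-tabulate⁻ : ∀ {n} (b : Fin n → Bool) → foldr _∧_ true (tabulate b) ≡ true → ∀ i → b i ≡ true
and-tabulate⁻ b all Fin.zero    = Bool.∧-conicalˡ _ _ all
and-tabulate⁻ b all (Fin.suc i) = and-tabulate⁻ (λ j → b (Fin.suc j)) (Bool.∧-conicalʳ (b Fin.zero) _ all) i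

and-tabulate⁺ : ∀ {n} (b : Fin n → Bool) → (∀ i → b i ≡ true) → foldr _∧_ true (tabulate b) ≡ true
and-tabulate⁺ {zero}  b all = refl
and-tabulate⁺ {suc n} b all = cong₂ _∧_ (all Fin.zero) (and-tabulate⁺ (λ j → b (Fin.suc j)) (λ j → all (Fin.suc j)))

count-tabulate : ∀ {X : Set} {n} (f : Fin n → X) (P : X → Bool) →
                 foldr (λ x acc → if P x then suc acc else acc) 0 (tabulate f) ≡ sum (λ i → [ P (f i) ])
count-tabulate {n = zero}  f P = refl
count-tabulate {n = suc n} f P = trans (if-suc (P (f Fin.zero)) _) (cong ([ P (f Fin.zero) ] +_) (count-tabulate (λ j → f (Fin.suc j)) P))
  where
  if-suc : ∀ b acc → (if b then suc acc else acc) ≡ [ b ] + acc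
  if-suc true  acc = refl
  if-suc false acc = refl

countFin-sum : ∀ n (P : Fin n → Bool) → countFin n P ≡ sum {n} (λ i → [ P i ])
countFin-sum n P = count-tabulate (λ i → i) P

∑-sum : ∀ q a n → ∑ q a n ≡ sum {n} (λ i → q (a + toℕ i))
∑-sum q a zero    = refl
∑-sum q a (suc n) = cong₂ _+_ (cong q (sym (+-identityʳ a))) (trans (∑-sum q (suc a) n) (sum-cong-≗ {n} λ i → cong q (sym (+-suc a (toℕ i)))))

countFin-∑ : ∀ n (P : Fin n → Bool) (q : ℕ → ℕ) → (∀ i → q (toℕ i) ≡ [ P i ]) → countFin n P ≡ ∑ q 0 n
countFin-∑ n P q eq = trans (countFin-sum n P) (trans (sum-cong-≗ (λ i → sym (eq i))) (sym (∑-sum q 0 n)))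

module Unrolling {k m} (a : Fin k) (rest : List (Fin k)) (Γ : Grid k (suc m)) where

  n last : ℕ
  n    = suc m
  last = length rest

  w : ℕ → Fin k
  w = wordAt a rest

  pos : ℕ → Fin n
  pos x = fromℕ< (m%n<n x n)

  G : ℕ → Fin k
  G x = Γ (pos x)

  -- bwd x is the appearance (x + last, −1): it reads w backwards, i.e. reverse w forwards from x.
  fwd bwd : ℕ → Bool
  fwd x = isAppearance (a ∷ rest) Γ (pos x) true
  bwd x = isAppearance (a ∷ rest) Γ (pos (x + last)) false

  private
    pos-cong : ∀ x y → x % n ≡ y % n → pos x ≡ pos y
    pos-cong x y e = Finₚ.toℕ-injective (trans (Finₚ.toℕ-fromℕ< (m%n<n x n)) (trans e (sym (Finₚ.toℕ-fromℕ< (m%n<n y n)))))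

    pos-toℕ : ∀ (i : Fin n) → pos (toℕ i) ≡ i
    pos-toℕ i = Finₚ.toℕ-injective (trans (Finₚ.toℕ-fromℕ< (m%n<n (toℕ i) n)) (m<n⇒m%n≡m (Finₚ.toℕ<n i)))

    toℕ-pos : ∀ x → toℕ (pos x) ≡ x % n
    toℕ-pos x = Finₚ.toℕ-fromℕ< (m%n<n x n)

    [m%n+i]%n : ∀ x i → (x % n + i) % n ≡ (x + i) % n
    [m%n+i]%n x i = trans (%-distribˡ-+ (x % n) i n) (trans (cong (λ z → (z + i % n) % n) (m%n%n≡m%n x n)) (sym (%-distribˡ-+ x i n)))

    [m%n+[n∸i%n]]%n : ∀ x i → i ≤ x → (x % n + (n ∸ i % n)) % n ≡ (x ∸ i) % n
    [m%n+[n∸i%n]]%n x i i≤x = begin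
      (x % n + (n ∸ r)) % n            ≡⟨ cong (λ z → (z + (n ∸ r)) % n) x%n ⟩
      ((y + r) % n + (n ∸ r)) % n      ≡⟨ [m%n+i]%n (y + r) (n ∸ r) ⟩
      (y + r + (n ∸ r)) % n            ≡⟨ cong (_% n) (trans (+-assoc y r (n ∸ r)) (cong (y +_) (m+[n∸m]≡n (m%n≤n i n)))) ⟩
      (y + n) % n                      ≡⟨ [m+n]%n≡m%n y n ⟩
      y % n                            ∎
      where
      open ≡-Reasoning
      y : ℕ
      y = x ∸ i
      r : ℕ
      r = i % n
      x%n : x % n ≡ (y + r) % n
      x%n = begin
        x % n                          ≡⟨ cong (_% n) (m∸n+n≡m i≤x) ⟨
        (y + i) % n                    ≡⟨ cong (λ z → (y + z) % n) (m≡m%n+[m/n]*n i n) ⟩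
        (y + (r + i / n * n)) % n      ≡⟨ cong (_% n) (+-assoc y r _) ⟨
        (y + r + i / n * n) % n        ≡⟨ [m+kn]%n≡m%n (y + r) (i / n) n ⟩
        (y + r) % n                    ∎

    shift-forward : ∀ x i → shift (pos x) true i ≡ pos (x + i)
    shift-forward x i = pos-cong (toℕ (pos x) + i) (x + i) (trans (cong (λ z → (z + i) % n) (toℕ-pos x)) ([m%n+i]%n x i))

    shift-backward : ∀ x j → j ≤ last → shift (pos (x + last)) false (last ∸ j) ≡ pos (x + j)
    shift-backward x j j≤last = pos-cong (toℕ (pos (x + last)) + (n ∸ (last ∸ j) % n)) (x + j) (begin
      (toℕ (pos (x + last)) + (n ∸ (last ∸ j) % n)) % n
        ≡⟨ cong (λ z → (z + (n ∸ (last ∸ j) % n)) % n) (toℕ-pos (x + last)) ⟩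
      ((x + last) % n + (n ∸ (last ∸ j) % n)) % n
        ≡⟨ [m%n+[n∸i%n]]%n (x + last) (last ∸ j) (≤-trans (m∸n≤m last j) (m≤n+m last x)) ⟩
      (x + last ∸ (last ∸ j)) % n
        ≡⟨ cong (_% n) (trans (+-∸-assoc x (m∸n≤m last j)) (cong (x +_) (m∸[m∸n]≡n j≤last))) ⟩
      (x + j) % n                                        ∎)
      where open ≡-Reasoning

    isAppearance-sound : ∀ q v → isAppearance (a ∷ rest) Γ q v ≡ true → ∀ i → i < suc last → Γ (shift q v i) ≡ w i
    isAppearance-sound q v app i i<ℓ =
      subst (λ z → Γ (shift q v z) ≡ w z) (Finₚ.toℕ-fromℕ< i<ℓ) (trans matches (lookup-wordAt a rest j))
      where
      j : Fin (suc last)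
      j = fromℕ< i<ℓ
      test : Fin (suc last) → Bool
      test j = ⌊ Γ (shift q v (toℕ j)) Finₚ.≟ lookup (a ∷ rest) j ⌋
      matches : Γ (shift q v (toℕ j)) ≡ lookup (a ∷ rest) j
      matches = toWitness (subst T (sym (and-tabulate⁻ test (trans (cong (foldr _∧_ true) (sym (map-tabulate (λ j → j) test))) app) j)) tt)

    isAppearance-complete : ∀ q v → (∀ i → i < suc last → Γ (shift q v i) ≡ w i) → isAppearance (a ∷ rest) Γ q v ≡ true
    isAppearance-complete q v matches = trans (cong (foldr _∧_ true) (map-tabulate (λ j → j) test)) (and-tabulate⁺ test λ j →
      trans (isYes≗does (Γ (shift q v (toℕ j)) Finₚ.≟ lookup (a ∷ rest) j))
            (dec-true (Γ (shift q v (toℕ j)) Finₚ.≟ _) (trans (matches (toℕ j) (Finₚ.toℕ<n j)) (sym (lookup-wordAt a rest j)))))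
      where
      test : Fin (suc last) → Bool
      test j = ⌊ Γ (shift q v (toℕ j)) Finₚ.≟ lookup (a ∷ rest) j ⌋

  fwd-sound : ∀ x → fwd x ≡ true → ∀ i → i < suc last → G (x + i) ≡ w i
  fwd-sound x app i i<ℓ = trans (cong Γ (sym (shift-forward x i))) (isAppearance-sound (pos x) true app i i<ℓ)

  fwd-complete : ∀ x → (∀ i → i < suc last → G (x + i) ≡ w i) → fwd x ≡ true
  fwd-complete x matches = isAppearance-complete (pos x) true λ i i<ℓ → trans (cong Γ (shift-forward x i)) (matches i i<ℓ)

  bwd-sound : ∀ x → bwd x ≡ true → ∀ i → i < suc last → G (x + i) ≡ reverse (suc last) w i
  bwd-sound x app i i<ℓ = trans (cong Γ (sym (shift-backward x i (s≤s⁻¹ i<ℓ))))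
                                (isAppearance-sound (pos (x + last)) false app (last ∸ i) (s≤s (m∸n≤m last i)))

  bwd-complete : ∀ x → (∀ i → i < suc last → G (x + i) ≡ reverse (suc last) w i) → bwd x ≡ true
  bwd-complete x matches = isAppearance-complete (pos (x + last)) false λ i i<ℓ → begin
    Γ (shift (pos (x + last)) false i)                ≡⟨ cong (λ z → Γ (shift (pos (x + last)) false z)) (m∸[m∸n]≡n (s≤s⁻¹ i<ℓ)) ⟨
    Γ (shift (pos (x + last)) false (last ∸ (last ∸ i)))  ≡⟨ cong Γ (shift-backward x (last ∸ i) (m∸n≤m last i)) ⟩
    G (x + (last ∸ i))                                ≡⟨ matches (last ∸ i) (s≤s (m∸n≤m last i)) ⟩
    w (last ∸ (last ∸ i))                             ≡⟨ cong w (m∸[m∸n]≡n (s≤s⁻¹ i<ℓ)) ⟩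
    w i                                               ∎
    where open ≡-Reasoning

  private
    pos-periodic : ∀ x → pos (x + n) ≡ pos x
    pos-periodic x = pos-cong (x + n) x ([m+n]%n≡m%n x n)

  G-periodic : ∀ x → G (x + n) ≡ G x
  G-periodic x = cong Γ (pos-periodic x)

  fwd-periodic : ∀ x → fwd (x + n) ≡ fwd x
  fwd-periodic x = cong (λ q → isAppearance (a ∷ rest) Γ q true) (pos-periodic x)

  bwd-periodic : ∀ x → bwd (x + n) ≡ bwd x
  bwd-periodic x = cong (λ q → isAppearance (a ∷ rest) Γ q false) (trans (cong pos (x+y+z≡x+z+y x n last)) (pos-periodic (x + last)))
    where
    x+y+z≡x+z+y : ∀ x y z → x + y + z ≡ x + z + y
    x+y+z≡x+z+y = solve-∀

  appearances-∑ : appearances (a ∷ rest) Γ ≡ ∑ (λ x → [ fwd x ] + [ bwd x ]) 0 n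
  appearances-∑ = trans (cong₂ _+_ forward backward) (sym (∑-distrib-+ (λ x → [ fwd x ]) (λ x → [ bwd x ]) 0 n))
    where
    appAt′ : Bool → Fin n → ℕ
    appAt′ v q = [ isAppearance (a ∷ rest) Γ q v ]
    appAt : Bool → ℕ → ℕ
    appAt v x = appAt′ v (pos x)
    counted : ∀ v → countFin n (λ q → isAppearance (a ∷ rest) Γ q v) ≡ ∑ (appAt v) 0 n
    counted v = countFin-∑ n _ (appAt v) λ i → cong (appAt′ v) (pos-toℕ i)
    forward : countFin n (λ q → isAppearance (a ∷ rest) Γ q true) ≡ ∑ (λ x → [ fwd x ]) 0 n
    forward = counted true
    backward : countFin n (λ q → isAppearance (a ∷ rest) Γ q false) ≡ ∑ (λ x → [ bwd x ]) 0 n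
    backward = begin
      countFin n (λ q → isAppearance (a ∷ rest) Γ q false)  ≡⟨ counted false ⟩
      ∑ (appAt false) 0 n                                  ≡⟨ ∑-rotate (appAt false) n (λ x → cong (appAt′ false) (pos-periodic x)) last ⟨
      ∑ (appAt false) last n                               ≡⟨ ∑-cong last 0 n (λ i _ → cong (appAt false) (+-comm last i)) ⟩
      ∑ (λ x → [ bwd x ]) 0 n                              ∎
      where open ≡-Reasoning

  letterCount-∑ : ∀ A → countFin n (λ x → ⌊ Γ x Finₚ.≟ A ⌋) ≡ ∑ (λ x → [ ⌊ G x Finₚ.≟ A ⌋ ]) 0 n
  letterCount-∑ A = countFin-∑ n _ _ λ i → cong (λ q → [ ⌊ Γ q Finₚ.≟ A ⌋ ]) (pos-toℕ i)

-- The extremal grid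

letterCount : ∀ {k m} → Grid k (suc m) → Fin k → ℕ
letterCount {m = m} Γ A = countFin (suc m) (λ x → ⌊ Γ x Finₚ.≟ A ⌋)

cyclicGrid : ∀ {k} → (ℕ → Fin k) → ∀ m → Grid k (suc m)
cyclicGrid u m x = u (toℕ x)

record ExtremalGrid {k} (w : Word k) : Set where
  field
    m*         : ℕ
    Γ*         : Grid k (suc m*)
    nontrivial : 1 ≤ appearances w Γ*
    dominates  : ∀ {m} (Γ : Grid k (suc m)) A → appearances w Γ * letterCount Γ* A ≤ appearances w Γ* * letterCount Γ A

module Extremal {k} (a : Fin k) (rest : List (Fin k)) where

  open WordStructure Finₚ._≟_ (wordAt a rest) (length rest)

  w : ℕ → Fin k
  w = wordAt a rest

  weighted-bound : ∀ {m} (Γ : Grid k (suc m)) A T →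
                   T ≤ ForLetter.periodCount A + ForLetter.periodCount A → T ≤ ForLetter.mixedCount A →
                   appearances (a ∷ rest) Γ * T ≤ letterCount Γ A + letterCount Γ A
  weighted-bound {m} Γ A T T≤2·period T≤mixed =
    subst₂ (λ N c → N * T ≤ c + c) (sym U.appearances-∑) (sym (U.letterCount-∑ A))
           (Occ.GapCounts.Threshold.weighted-bound A T T≤2·period T≤mixed (suc m) U.G-periodic U.fwd-periodic U.bwd-periodic)
    where
    module U = Unrolling a rest Γ
    module Occ = Occurrences Finₚ._≟_ U.w U.last U.G U.fwd U.bwd U.fwd-sound U.bwd-sound

  private
    module Periodic where

      Γ : Grid k (suc p⁻)
      Γ = cyclicGrid w p⁻

      module U = Unrolling a rest Γ

      forward-at-0 : U.fwd 0 ≡ true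
      forward-at-0 = U.fwd-complete 0 λ i i<ℓ → trans (cong w (Finₚ.toℕ-fromℕ< (m%n<n i p))) (HasPeriod-mod period i i<ℓ)

      nontrivial : 1 ≤ appearances (a ∷ rest) Γ
      nontrivial = subst (1 ≤_) (sym U.appearances-∑)
        (≤-trans (subst (λ b → 1 ≤ [ b ] + [ U.bwd 0 ]) (sym forward-at-0) (s≤s z≤n)) (∑-point _ 0 {p} {0} z<s))

      letterCount≡ : ∀ A → letterCount Γ A ≡ ForLetter.periodCount A
      letterCount≡ A = trans (U.letterCount-∑ A)
        (∑-cong 0 0 p λ i i<p → cong (δ A) (cong w (trans (Finₚ.toℕ-fromℕ< (m%n<n i p)) (m<n⇒m%n≡m i<p))))

    module Mixed where

      D⁻ : ℕ
      D⁻ = d₁ + d₂⁻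

      d₁+d₂≡D : d₁ + d₂ ≡ suc D⁻
      d₁+d₂≡D = +-suc d₁ d₂⁻

      u : ℕ → Fin k
      u = w ++⟨ d₁ ⟩ reverse ℓ w

      Γ : Grid k (suc D⁻)
      Γ = cyclicGrid u D⁻

      module U = Unrolling a rest Γ

      u≗w : ∀ i → i < ℓ → u i ≡ w i
      u≗w i i<ℓ = by-cases (i <? d₁)
        where
        by-cases : Dec (i < d₁) → u i ≡ w i
        by-cases (yes i<d₁) = ++-left {u = w} {reverse ℓ w} i<d₁
        by-cases (no i≮d₁)  = begin
          u i                      ≡⟨ ++-right {u = w} {reverse ℓ w} d₁≤i ⟩
          reverse ℓ w (i ∸ d₁)     ≡⟨ suffix-reverse {w = w} {ℓ} {d₁} suffix (i ∸ d₁) (∸-monoˡ-< i<ℓ d₁≤i) ⟩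
          w (d₁ + (i ∸ d₁))        ≡⟨ cong w (m+[n∸m]≡n d₁≤i) ⟩
          w i                      ∎
          where
          open ≡-Reasoning
          d₁≤i : d₁ ≤ i
          d₁≤i = ≮⇒≥ i≮d₁

      u-mod : ∀ i → i < ℓ → u (i % suc D⁻) ≡ w i
      u-mod i i<ℓ = trans (u≗w (i % suc D⁻) (≤-<-trans (m%n≤m i (suc D⁻)) i<ℓ))
                          (HasPeriod-mod (subst (HasPeriod w ℓ) d₁+d₂≡D (palindromes⇒period {ℓ = ℓ} {d₁} {d₂} suffix prefix)) i i<ℓ)

      u-mod-reverse : ∀ j → j < ℓ → u ((d₁ + j) % suc D⁻) ≡ reverse ℓ w j
      u-mod-reverse j j<ℓ with d₁ + j <? suc D⁻
      ... | yes lt = trans (cong u (m<n⇒m%n≡m lt)) (trans (++-right {u = w} {reverse ℓ w} (m≤m+n d₁ j)) (cong (reverse ℓ w) (m+n∸m≡n d₁ j)))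
      ... | no ≮D = begin
        u ((d₁ + j) % suc D⁻)          ≡⟨ cong (λ z → u (z % suc D⁻)) d₁+j≡t+D ⟩
        u ((t + suc D⁻) % suc D⁻)      ≡⟨ cong u ([m+n]%n≡m%n t (suc D⁻)) ⟩
        u (t % suc D⁻)                 ≡⟨ u-mod t (≤-<-trans (m∸n≤m j d₂) j<ℓ) ⟩
        w t                            ≡⟨ prefix-reverse {w = w} {ℓ} {d₂} prefix j d₂≤j j<ℓ ⟩
        reverse ℓ w j                  ∎
        where
        open ≡-Reasoning
        d₂≤j : d₂ ≤ j
        d₂≤j = +-cancelˡ-≤ d₁ _ _ (subst (_≤ d₁ + j) (sym d₁+d₂≡D) (≮⇒≥ ≮D))
        t : ℕ
        t = j ∸ d₂
        d₁+j≡t+D : d₁ + j ≡ t + suc D⁻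
        d₁+j≡t+D = begin
          d₁ + j            ≡⟨ cong (d₁ +_) (m∸n+n≡m d₂≤j) ⟨
          d₁ + (t + d₂)     ≡⟨ x+[y+z]≡y+[x+z] d₁ t d₂ ⟩
          t + (d₁ + d₂)     ≡⟨ cong (t +_) d₁+d₂≡D ⟩
          t + suc D⁻        ∎

      forward-at-0 : U.fwd 0 ≡ true
      forward-at-0 = U.fwd-complete 0 λ i i<ℓ → trans (cong u (Finₚ.toℕ-fromℕ< (m%n<n i (suc D⁻)))) (u-mod i i<ℓ)

      backward-at-d₁ : U.bwd d₁ ≡ true
      backward-at-d₁ = U.bwd-complete d₁ λ j j<ℓ → trans (cong u (Finₚ.toℕ-fromℕ< (m%n<n (d₁ + j) (suc D⁻)))) (u-mod-reverse j j<ℓ)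

      twice-nontrivial : 2 ≤ appearances (a ∷ rest) Γ
      twice-nontrivial = subst (2 ≤_) (sym (trans U.appearances-∑ (∑-distrib-+ (λ x → [ U.fwd x ]) (λ x → [ U.bwd x ]) 0 (suc D⁻))))
        (+-mono-≤ (≤-trans (subst (λ b → 1 ≤ [ b ]) (sym forward-at-0) ≤-refl) (∑-point (λ x → [ U.fwd x ]) 0 {suc D⁻} {0} z<s))
                  (≤-trans (subst (λ b → 1 ≤ [ b ]) (sym backward-at-d₁) ≤-refl)
                           (∑-point (λ x → [ U.bwd x ]) 0 {suc D⁻} {d₁} (s≤s (m≤m+n d₁ d₂⁻)))))

      letterCount≡ : ∀ A → letterCount Γ A ≡ ForLetter.mixedCount A
      letterCount≡ A = begin
        letterCount Γ A                                 ≡⟨ U.letterCount-∑ A ⟩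
        ∑ (λ x → δ A (U.G x)) 0 (suc D⁻)
          ≡⟨ ∑-cong 0 0 (suc D⁻) (λ i i<D → cong (λ z → δ A (u z)) (trans (Finₚ.toℕ-fromℕ< (m%n<n i (suc D⁻))) (m<n⇒m%n≡m i<D))) ⟩
        ∑ (λ i → δ A (u i)) 0 (suc D⁻)                   ≡⟨ cong (∑ (λ i → δ A (u i)) 0) d₁+d₂≡D ⟨
        ∑ (λ i → δ A (u i)) 0 (d₁ + d₂)                  ≡⟨ ∑-++⟨⟩ {u = w} {reverse ℓ w} {d₁} (δ A) d₂ ⟩
        ForLetter.mixedCount A                          ∎
        where open ≡-Reasoning

  private
    halve : ∀ {x y} → x + x ≤ y + y → x ≤ y
    halve {x} {y} x+x≤y+y = ≮⇒≥ λ y<x → <⇒≱ (+-mono-< y<x y<x) x+x≤y+y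

    periodic-dominates : p + p ≤ d₁ + d₂ → ∀ {m} (Γ : Grid k (suc m)) A →
                         appearances (a ∷ rest) Γ * letterCount Periodic.Γ A ≤ appearances (a ∷ rest) Periodic.Γ * letterCount Γ A
    periodic-dominates 2p≤d₁+d₂ Γ A = begin
      N * letterCount Periodic.Γ A      ≡⟨ cong (N *_) (Periodic.letterCount≡ A) ⟩
      N * periodCount                   ≤⟨ halve (subst (_≤ letterCount Γ A + letterCount Γ A) (*-distribˡ-+ N periodCount periodCount) bound) ⟩
      letterCount Γ A                   ≡⟨ *-identityˡ (letterCount Γ A) ⟨
      1 * letterCount Γ A               ≤⟨ *-monoˡ-≤ (letterCount Γ A) Periodic.nontrivial ⟩
      appearances (a ∷ rest) Periodic.Γ * letterCount Γ A ∎
      where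
      open ≤-Reasoning
      open ForLetter A
      N : ℕ
      N = appearances (a ∷ rest) Γ
      bound : N * (periodCount + periodCount) ≤ letterCount Γ A + letterCount Γ A
      bound = weighted-bound Γ A (periodCount + periodCount) ≤-refl (twice-period≤mixed 2p≤d₁+d₂)

    mixed-dominates : d₁ + d₂ < p + p → ∀ {m} (Γ : Grid k (suc m)) A →
                      appearances (a ∷ rest) Γ * letterCount Mixed.Γ A ≤ appearances (a ∷ rest) Mixed.Γ * letterCount Γ A
    mixed-dominates d₁+d₂<2p Γ A = begin
      N * letterCount Mixed.Γ A         ≡⟨ cong (N *_) (Mixed.letterCount≡ A) ⟩
      N * mixedCount                    ≤⟨ weighted-bound Γ A mixedCount (mixed≤twice-period d₁+d₂<2p) ≤-refl ⟩
      letterCount Γ A + letterCount Γ A ≡⟨ cong (letterCount Γ A +_) (+-identityʳ (letterCount Γ A)) ⟨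
      2 * letterCount Γ A               ≤⟨ *-monoˡ-≤ (letterCount Γ A) Mixed.twice-nontrivial ⟩
      appearances (a ∷ rest) Mixed.Γ * letterCount Γ A ∎
      where
      open ≤-Reasoning
      open ForLetter A
      N : ℕ
      N = appearances (a ∷ rest) Γ

  extremal : ExtremalGrid (a ∷ rest)
  extremal with p + p ≤? d₁ + d₂
  ... | yes 2p≤d₁+d₂ = record { m* = p⁻ ; Γ* = Periodic.Γ ; nontrivial = Periodic.nontrivial
                              ; dominates = periodic-dominates 2p≤d₁+d₂ }
  ... | no 2p≰d₁+d₂  = record { m* = Mixed.D⁻ ; Γ* = Mixed.Γ ; nontrivial = ≤-trans (s≤s z≤n) Mixed.twice-nontrivial
                              ; dominates = mixed-dominates (≰⇒> 2p≰d₁+d₂) }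

-- Fractions and total variation

toℚᵘ-/ : ∀ a d → ℚ.toℚᵘ ((ℤ.+ a) ℚ./ suc d) ℚᵘ.≃ mkℚᵘ (ℤ.+ a) d
toℚᵘ-/ a d = ℚₚ.toℚᵘ-fromℚᵘ (mkℚᵘ (ℤ.+ a) d)

module _ (a b d e : ℕ) where

  private
    cross : ∀ x y → (ℤ.+ x) ℤ.* (ℤ.+ y) ≡ ℤ.+ (x * y)
    cross x y = sym (ℤₚ.pos-* x y)

  /-cong-cross : a * suc e ≡ b * suc d → (ℤ.+ a) ℚ./ suc d ≡ (ℤ.+ b) ℚ./ suc e
  /-cong-cross eq =
    ℚₚ.toℚᵘ-injective (ℚᵘₚ.≃-trans (toℚᵘ-/ a d) (ℚᵘₚ.≃-trans (*≡* cross-eq) (ℚᵘₚ.≃-sym (toℚᵘ-/ b e))))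
    where
    cross-eq : (ℤ.+ a) ℤ.* (ℤ.+ suc e) ≡ (ℤ.+ b) ℤ.* (ℤ.+ suc d)
    cross-eq = trans (cross a (suc e)) (trans (cong ℤ.+_ eq) (sym (cross b (suc d))))

  /-mono-cross : a * suc e ≤ b * suc d → (ℤ.+ a) ℚ./ suc d ℚ.≤ (ℤ.+ b) ℚ./ suc e
  /-mono-cross le =
    ℚₚ.toℚᵘ-cancel-≤ (ℚᵘₚ.≤-respˡ-≃ (ℚᵘₚ.≃-sym (toℚᵘ-/ a d)) (ℚᵘₚ.≤-respʳ-≃ (ℚᵘₚ.≃-sym (toℚᵘ-/ b e)) (*≤* cross-le)))
    where
    cross-le : (ℤ.+ a) ℤ.* (ℤ.+ suc e) ℤ.≤ (ℤ.+ b) ℤ.* (ℤ.+ suc d)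
    cross-le = subst₂ ℤ._≤_ (sym (cross a (suc e))) (sym (cross b (suc d))) (ℤ.+≤+ le)

  /-*-/ : ((ℤ.+ a) ℚ./ suc d) ℚ.* ((ℤ.+ b) ℚ./ suc e) ≡ (ℤ.+ (a * b)) ℚ./ (suc d * suc e)
  /-*-/ = ℚₚ.toℚᵘ-injective (ℚᵘₚ.≃-trans (ℚₚ.toℚᵘ-homo-* ((ℤ.+ a) ℚ./ suc d) ((ℤ.+ b) ℚ./ suc e))
    (ℚᵘₚ.≃-trans (ℚᵘₚ.*-cong (toℚᵘ-/ a d) (toℚᵘ-/ b e))
      (ℚᵘₚ.≃-trans (ℚᵘₚ.≃-reflexive (cong (λ z → mkℚᵘ z _) (cross a b))) (ℚᵘₚ.≃-sym (toℚᵘ-/ (a * b) _)))))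

/-+-common : ∀ a b d → (ℤ.+ a) ℚ./ suc d ℚ.+ (ℤ.+ b) ℚ./ suc d ≡ (ℤ.+ (a + b)) ℚ./ suc d
/-+-common a b d = ℚₚ.toℚᵘ-injective (ℚᵘₚ.≃-trans (ℚₚ.toℚᵘ-homo-+ ((ℤ.+ a) ℚ./ suc d) ((ℤ.+ b) ℚ./ suc d))
  (ℚᵘₚ.≃-trans (ℚᵘₚ.+-cong (toℚᵘ-/ a d) (toℚᵘ-/ b d))
    (ℚᵘₚ.≃-trans (*≡* numerators) (ℚᵘₚ.≃-sym (toℚᵘ-/ (a + b) d)))))
  where
  D : ℤ.ℤ
  D = ℤ.+ suc d
  numerators : ((ℤ.+ a) ℤ.* D ℤ.+ (ℤ.+ b) ℤ.* D) ℤ.* D ≡ (ℤ.+ (a + b)) ℤ.* (ℤ.+ (suc d * suc d))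
  numerators = begin
    ((ℤ.+ a) ℤ.* D ℤ.+ (ℤ.+ b) ℤ.* D) ℤ.* D      ≡⟨ cong (ℤ._* D) (ℤₚ.*-distribʳ-+ D (ℤ.+ a) (ℤ.+ b)) ⟨
    ((ℤ.+ a) ℤ.+ (ℤ.+ b)) ℤ.* D ℤ.* D            ≡⟨ ℤₚ.*-assoc ((ℤ.+ a) ℤ.+ (ℤ.+ b)) D D ⟩
    ((ℤ.+ a) ℤ.+ (ℤ.+ b)) ℤ.* (D ℤ.* D)          ≡⟨ cong₂ ℤ._*_ (sym (ℤₚ.pos-+ a b)) (sym (ℤₚ.pos-* (suc d) (suc d))) ⟩
    (ℤ.+ (a + b)) ℤ.* (ℤ.+ (suc d * suc d))      ∎
    where open ≡-Reasoning

∣⊖∣≡∣-∣ : ∀ x y → ℤ.∣ x ℤ.⊖ y ∣ ≡ ∣ x - y ∣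
∣⊖∣≡∣-∣ x y with ≤-total x y
... | inj₁ x≤y = trans (ℤₚ.∣⊖∣-≤ x≤y) (sym (m≤n⇒∣m-n∣≡n∸m x≤y))
... | inj₂ y≤x = trans (ℤₚ.∣m⊖n∣≡∣n⊖m∣ x y) (trans (ℤₚ.∣⊖∣-≤ y≤x) (sym (m≤n⇒∣n-m∣≡n∸m y≤x)))

∣/-/∣ : ∀ a b d e →
        ℚ.∣ (ℤ.+ a) ℚ./ suc d ℚ.- (ℤ.+ b) ℚ./ suc e ∣ ≡ (ℤ.+ ∣ a * suc e - b * suc d ∣) ℚ./ (suc d * suc e)
∣/-/∣ a b d e = ℚₚ.toℚᵘ-injective (ℚᵘₚ.≃-trans (ℚₚ.toℚᵘ-homo-∣-∣ (x ℚ.- y))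
  (ℚᵘₚ.≃-trans (ℚᵘₚ.∣-∣-cong difference)
    (ℚᵘₚ.≃-trans (ℚᵘₚ.≃-reflexive (cong (λ z → mkℚᵘ (ℤ.+ z) _) numerator)) (ℚᵘₚ.≃-sym (toℚᵘ-/ _ _)))))
  where
  x y : ℚ
  x = (ℤ.+ a) ℚ./ suc d
  y = (ℤ.+ b) ℚ./ suc e
  difference : ℚ.toℚᵘ (x ℚ.- y) ℚᵘ.≃ mkℚᵘ (ℤ.+ a) d ℚᵘ.- mkℚᵘ (ℤ.+ b) e
  difference = ℚᵘₚ.≃-trans (ℚₚ.toℚᵘ-homo-+ x (ℚ.- y))
                           (ℚᵘₚ.+-cong (toℚᵘ-/ a d) (ℚᵘₚ.≃-trans (ℚₚ.toℚᵘ-homo‿- y) (ℚᵘₚ.-‿cong (toℚᵘ-/ b e))))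
  numerator : ℤ.∣ (ℤ.+ a) ℤ.* (ℤ.+ suc e) ℤ.+ (ℤ.- (ℤ.+ b)) ℤ.* (ℤ.+ suc d) ∣ ≡ ∣ a * suc e - b * suc d ∣
  numerator = begin
    ℤ.∣ (ℤ.+ a) ℤ.* (ℤ.+ suc e) ℤ.+ (ℤ.- (ℤ.+ b)) ℤ.* (ℤ.+ suc d) ∣
      ≡⟨ cong (λ z → ℤ.∣ (ℤ.+ a) ℤ.* (ℤ.+ suc e) ℤ.+ z ∣) (ℤₚ.neg-distribˡ-* (ℤ.+ b) (ℤ.+ suc d)) ⟨
    ℤ.∣ (ℤ.+ a) ℤ.* (ℤ.+ suc e) ℤ.- (ℤ.+ b) ℤ.* (ℤ.+ suc d) ∣
      ≡⟨ cong₂ (λ u v → ℤ.∣ u ℤ.- v ∣) (ℤₚ.pos-* a (suc e)) (ℤₚ.pos-* b (suc d)) ⟨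
    ℤ.∣ ℤ.+ (a * suc e) ℤ.- ℤ.+ (b * suc d) ∣
      ≡⟨ cong ℤ.∣_∣ (ℤₚ.m-n≡m⊖n (a * suc e) (b * suc d)) ⟩
    ℤ.∣ (a * suc e) ℤ.⊖ (b * suc d) ∣
      ≡⟨ ∣⊖∣≡∣-∣ (a * suc e) (b * suc d) ⟩
    ∣ a * suc e - b * suc d ∣
      ∎
    where open ≡-Reasoning

x+y≡z⇒z-y≡x : ∀ {x y z} → x ℚ.+ y ≡ z → z ℚ.- y ≡ x
x+y≡z⇒z-y≡x {x} {y} refl = begin
  (x ℚ.+ y) ℚ.- y          ≡⟨ ℚₚ.+-assoc x y (ℚ.- y) ⟩
  x ℚ.+ (y ℚ.- y)          ≡⟨ cong (x ℚ.+_) (ℚₚ.+-inverseʳ y) ⟩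
  x ℚ.+ ℚ.0ℚ               ≡⟨ ℚₚ.+-identityʳ x ⟩
  x                        ∎
  where open ≡-Reasoning

Σℚ-/ : ∀ {k} (h : Fin k → ℚ) (x : Fin k → ℕ) d → (∀ A → h A ≡ (ℤ.+ x A) ℚ./ suc d) → Σℚ k h ≡ (ℤ.+ sum x) ℚ./ suc d
Σℚ-/ {k} h x d eq = trans (cong (foldr ℚ._+_ ℚ.0ℚ) (map-tabulate (λ A → A) h)) (tabulated h x eq)
  where
  tabulated : ∀ {k} (h : Fin k → ℚ) (x : Fin k → ℕ) → (∀ A → h A ≡ (ℤ.+ x A) ℚ./ suc d) →
              foldr ℚ._+_ ℚ.0ℚ (tabulate h) ≡ (ℤ.+ sum x) ℚ./ suc d
  tabulated {zero}  h x eq = /-cong-cross 0 0 0 d refl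
  tabulated {suc k} h x eq = trans (cong₂ ℚ._+_ (eq Fin.zero) (tabulated (λ A → h (Fin.suc A)) (λ A → x (Fin.suc A)) (λ A → eq (Fin.suc A))))
                                   (/-+-common (x Fin.zero) (sum (λ A → x (Fin.suc A))) d)

sum-mono-≤ : ∀ {k} {x y : Fin k → ℕ} → (∀ A → x A ≤ y A) → sum x ≤ sum y
sum-mono-≤ {zero}  le = z≤n
sum-mono-≤ {suc k} le = +-mono-≤ (le Fin.zero) (sum-mono-≤ (λ A → le (Fin.suc A)))

sum-ones : ∀ n → sum {n} (λ _ → 1) ≡ n
sum-ones zero    = refl
sum-ones (suc n) = cong suc (sum-ones n)

sum-δ : ∀ {k} (x : Fin k) → sum (λ A → [ ⌊ x Finₚ.≟ A ⌋ ]) ≡ 1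
sum-δ {suc k} Fin.zero    = cong suc (zeros k)
  where
  zeros : ∀ k → sum {k} (λ _ → 0) ≡ 0
  zeros zero    = refl
  zeros (suc k) = zeros k
sum-δ {suc k} (Fin.suc x) = trans (sum-cong-≗ {k} λ A → cong [_] (suc-≟-suc A)) (sum-δ x)
  where
  suc-≟-suc : ∀ A → ⌊ Fin.suc x Finₚ.≟ Fin.suc A ⌋ ≡ ⌊ x Finₚ.≟ A ⌋
  suc-≟-suc A with x Finₚ.≟ A
  ... | yes _ = refl
  ... | no _  = refl


letterCount-total : ∀ {k m} (Γ : Grid k (suc m)) → sum (letterCount Γ) ≡ suc m
letterCount-total {k} {m} Γ = begin
  sum (letterCount Γ)                                          ≡⟨ sum-cong-≗ {k} (λ A → countFin-sum (suc m) _) ⟩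
  sum (λ A → sum {suc m} (λ x → [ ⌊ Γ x Finₚ.≟ A ⌋ ]))        ≡⟨ sum-comm (λ A x → [ ⌊ Γ x Finₚ.≟ A ⌋ ]) ⟩
  sum (λ x → sum {k} (λ A → [ ⌊ Γ x Finₚ.≟ A ⌋ ]))            ≡⟨ sum-cong-≗ {suc m} (λ x → sum-δ (Γ x)) ⟩
  sum {suc m} (λ _ → 1)                                        ≡⟨ sum-ones (suc m) ⟩
  suc m                                                        ∎
  where open ≡-Reasoning

letterCount≤size : ∀ {k m} (Γ : Grid k (suc m)) A → letterCount Γ A ≤ suc m
letterCount≤size {m = m} Γ A = begin
  letterCount Γ A                                   ≡⟨ countFin-sum (suc m) _ ⟩
  sum {suc m} (λ x → [ ⌊ Γ x Finₚ.≟ A ⌋ ])         ≤⟨ sum-mono-≤ (λ x → [b]≤1 ⌊ Γ x Finₚ.≟ A ⌋) ⟩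
  sum {suc m} (λ _ → 1)                             ≡⟨ sum-ones (suc m) ⟩
  suc m                                             ∎
  where
  open ≤-Reasoning
  [b]≤1 : ∀ b → [ b ] ≤ 1
  [b]≤1 true  = ≤-refl
  [b]≤1 false = z≤n

hGrid-isLetterDistribution : ∀ {k m} (Γ : Grid k (suc m)) → IsLetterDistribution (hGrid Γ)
hGrid-isLetterDistribution {m = m} Γ A =
  /-mono-cross 0 (letterCount Γ A) 0 m z≤n ,
  /-mono-cross (letterCount Γ A) 1 m 0 (subst₂ _≤_ (sym (*-identityʳ _)) (sym (+-identityʳ _)) (letterCount≤size Γ A))

⊓+⊓+∣-∣ : ∀ x y → x ⊓ y + x ⊓ y + ∣ x - y ∣ ≡ x + y
⊓+⊓+∣-∣ x y with ≤-total x y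
... | inj₁ x≤y = begin
  x ⊓ y + x ⊓ y + ∣ x - y ∣   ≡⟨ cong₂ (λ a b → a + a + b) (m≤n⇒m⊓n≡m x≤y) (m≤n⇒∣m-n∣≡n∸m x≤y) ⟩
  x + x + (y ∸ x)             ≡⟨ +-assoc x x (y ∸ x) ⟩
  x + (x + (y ∸ x))           ≡⟨ cong (x +_) (m+[n∸m]≡n x≤y) ⟩
  x + y                       ∎
  where open ≡-Reasoning
... | inj₂ y≤x = begin
  x ⊓ y + x ⊓ y + ∣ x - y ∣   ≡⟨ cong₂ (λ a b → a + a + b) (m≥n⇒m⊓n≡n y≤x) (m≤n⇒∣n-m∣≡n∸m y≤x) ⟩
  y + y + (x ∸ y)             ≡⟨ +-assoc y y (x ∸ y) ⟩
  y + (y + (x ∸ y))           ≡⟨ cong (y +_) (m+[n∸m]≡n y≤x) ⟩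
  y + x                       ≡⟨ +-comm y x ⟩
  x + y                       ∎
  where open ≡-Reasoning

sharedCount : ∀ {k} → (Fin k → ℕ) → (Fin k → ℕ) → ℕ
sharedCount X Y = sum (λ A → X A ⊓ Y A)

sharedCount-decomposition : ∀ {k} (X Y : Fin k → ℕ) →
                            sharedCount X Y + sharedCount X Y + sum (λ A → ∣ X A - Y A ∣) ≡ sum X + sum Y
sharedCount-decomposition {k} X Y = begin
  sum (λ A → X A ⊓ Y A) + sum (λ A → X A ⊓ Y A) + sum (λ A → ∣ X A - Y A ∣)
    ≡⟨ cong (_+ sum (λ A → ∣ X A - Y A ∣)) (sum-distrib-+ (λ A → X A ⊓ Y A) (λ A → X A ⊓ Y A)) ⟨
  sum (λ A → X A ⊓ Y A + X A ⊓ Y A) + sum (λ A → ∣ X A - Y A ∣)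
    ≡⟨ sum-distrib-+ (λ A → X A ⊓ Y A + X A ⊓ Y A) (λ A → ∣ X A - Y A ∣) ⟨
  sum (λ A → X A ⊓ Y A + X A ⊓ Y A + ∣ X A - Y A ∣)
    ≡⟨ sum-cong-≗ {k} (λ A → ⊓+⊓+∣-∣ (X A) (Y A)) ⟩
  sum (λ A → X A + Y A)
    ≡⟨ sum-distrib-+ X Y ⟩
  sum X + sum Y
    ∎
  where open ≡-Reasoning

TV-/ : ∀ {k} (x y : Fin k → ℕ) d e →
       TV (λ A → (ℤ.+ x A) ℚ./ suc d) (λ A → (ℤ.+ y A) ℚ./ suc e)
       ≡ (ℤ.+ sum (λ A → ∣ x A * suc e - y A * suc d ∣)) ℚ./ (2 * (suc d * suc e))
TV-/ {k} x y d e = begin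
  ℚ.½ ℚ.* Σℚ k (λ A → ℚ.∣ (ℤ.+ x A) ℚ./ suc d ℚ.- (ℤ.+ y A) ℚ./ suc e ∣)
    ≡⟨ cong (ℚ.½ ℚ.*_) (Σℚ-/ _ (λ A → ∣ x A * suc e - y A * suc d ∣) (e + d * suc e) (λ A → ∣/-/∣ (x A) (y A) d e)) ⟩
  ℚ.½ ℚ.* ((ℤ.+ s) ℚ./ (suc d * suc e))
    ≡⟨ /-*-/ 1 s 1 (e + d * suc e) ⟩
  (ℤ.+ (1 * s)) ℚ./ (2 * (suc d * suc e))
    ≡⟨ cong (λ z → (ℤ.+ z) ℚ./ (2 * (suc d * suc e))) (*-identityˡ s) ⟩
  (ℤ.+ s) ℚ./ (2 * (suc d * suc e))
    ∎
  where
  open ≡-Reasoning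
  s : ℕ
  s = sum (λ A → ∣ x A * suc e - y A * suc d ∣)

1-TV≡sharedCount : ∀ {k} (x y : Fin k → ℕ) d e → sum x ≡ suc d → sum y ≡ suc e →
                   1ℚ - TV (λ A → (ℤ.+ x A) ℚ./ suc d) (λ A → (ℤ.+ y A) ℚ./ suc e)
                   ≡ (ℤ.+ sharedCount (λ A → x A * suc e) (λ A → y A * suc d)) ℚ./ (suc d * suc e)
1-TV≡sharedCount {k} x y d e x-total y-total = x+y≡z⇒z-y≡x (begin
  (ℤ.+ o) ℚ./ D ℚ.+ TV hx hy                        ≡⟨ cong₂ ℚ._+_ (/-cong-cross o (o + o) _ _ (o*2D≡[o+o]*D o D)) (TV-/ x y d e) ⟩
  (ℤ.+ (o + o)) ℚ./ (2 * D) ℚ.+ (ℤ.+ s) ℚ./ (2 * D) ≡⟨ /-+-common (o + o) s _ ⟩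
  (ℤ.+ (o + o + s)) ℚ./ (2 * D)                     ≡⟨ cong (λ z → (ℤ.+ z) ℚ./ (2 * D)) o+o+s≡D+D ⟩
  (ℤ.+ (D + D)) ℚ./ (2 * D)                         ≡⟨ /-cong-cross (D + D) 1 _ 0 (D+D≡2D D) ⟩
  1ℚ                                                ∎)
  where
  open ≡-Reasoning
  D : ℕ
  D = suc d * suc e
  hx hy : Fin k → ℚ
  hx A = (ℤ.+ x A) ℚ./ suc d
  hy A = (ℤ.+ y A) ℚ./ suc e
  X Y : Fin k → ℕ
  X A = x A * suc e
  Y A = y A * suc d
  o s : ℕ
  o = sharedCount X Y
  s = sum (λ A → ∣ X A - Y A ∣)
  o*2D≡[o+o]*D : ∀ o D → o * (2 * D) ≡ (o + o) * D
  o*2D≡[o+o]*D = solve-∀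
  D+D≡2D : ∀ D → (D + D) * 1 ≡ 1 * (2 * D)
  D+D≡2D = solve-∀
  o+o+s≡D+D : o + o + s ≡ D + D
  o+o+s≡D+D = trans (sharedCount-decomposition X Y) (cong₂ _+_ ΣX≡D ΣY≡D)
    where
    ΣX≡D : sum X ≡ D
    ΣX≡D = trans (sym (*-distribʳ-sum (suc e) x)) (cong (_* suc e) x-total)
    ΣY≡D : sum Y ≡ D
    ΣY≡D = trans (sym (*-distribʳ-sum (suc d) y)) (trans (cong (_* suc d) y-total) (*-comm (suc e) (suc d)))

module _ {k} {w : Word k} (E : ExtremalGrid w) where

  open ExtremalGrid E

  private
    n* N* : ℕ
    n* = suc m*
    N* = appearances w Γ*

    shared : ∀ {m} → Grid k (suc m) → ℕ
    shared {m} Γ = sharedCount (λ A → letterCount Γ A * n*) (λ A → letterCount Γ* A * suc m)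

  dominates-total : ∀ {m} (Γ : Grid k (suc m)) → appearances w Γ * n* ≤ N* * suc m
  dominates-total {m} Γ = begin
    N * n*                              ≡⟨ cong (N *_) (letterCount-total Γ*) ⟨
    N * sum (letterCount Γ*)            ≡⟨ *-distribˡ-sum N (letterCount Γ*) ⟩
    sum (λ A → N * letterCount Γ* A)    ≤⟨ sum-mono-≤ (dominates Γ) ⟩
    sum (λ A → N* * letterCount Γ A)    ≡⟨ *-distribˡ-sum N* (letterCount Γ) ⟨
    N* * sum (letterCount Γ)            ≡⟨ cong (N* *_) (letterCount-total Γ) ⟩
    N* * suc m                          ∎
    where
    open ≤-Reasoning
    N : ℕ
    N = appearances w Γ

  dominates-shared : ∀ {m} (Γ : Grid k (suc m)) → appearances w Γ * n* * n* ≤ N* * shared Γ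
  dominates-shared {m} Γ = begin
    N * n* * n*                                        ≡⟨ cong (N * n* *_) (letterCount-total Γ*) ⟨
    N * n* * sum (letterCount Γ*)                      ≡⟨ *-distribˡ-sum (N * n*) (letterCount Γ*) ⟩
    sum (λ A → N * n* * letterCount Γ* A)              ≤⟨ sum-mono-≤ per-letter ⟩
    sum (λ A → N* * ((letterCount Γ A * n*) ⊓ (letterCount Γ* A * suc m)))
                                                       ≡⟨ *-distribˡ-sum N* (λ A → (letterCount Γ A * n*) ⊓ (letterCount Γ* A * suc m)) ⟨
    N* * shared Γ                                      ∎
    where
    open ≤-Reasoning
    N : ℕ
    N = appearances w Γ
    per-letter : ∀ A → N * n* * letterCount Γ* A ≤ N* * ((letterCount Γ A * n*) ⊓ (letterCount Γ* A * suc m))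
    per-letter A = subst (N * n* * b ≤_) (sym (*-distribˡ-⊓ N* (a * n*) (b * suc m))) (⊓-glb via-letter via-total)
      where
      a : ℕ
      a = letterCount Γ A
      b : ℕ
      b = letterCount Γ* A
      via-letter : N * n* * b ≤ N* * (a * n*)
      via-letter = subst₂ _≤_ (x*y*z≡x*z*y N b n*) (*-assoc N* a n*) (*-monoˡ-≤ n* (dominates Γ A))
        where
        x*y*z≡x*z*y : ∀ x y z → x * y * z ≡ x * z * y
        x*y*z≡x*z*y = solve-∀
      via-total : N * n* * b ≤ N* * (b * suc m)
      via-total = subst (N * n* * b ≤_) (x*y*z≡x*[z*y] N* (suc m) b) (*-monoˡ-≤ b (dominates-total Γ))
        where
        x*y*z≡x*[z*y] : ∀ x y z → x * y * z ≡ x * (z * y)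
        x*y*z≡x*[z*y] = solve-∀

  1-TV≡shared : ∀ {m} (Γ : Grid k (suc m)) → 1ℚ - TV (hGrid Γ) (hGrid Γ*) ≡ (ℤ.+ shared Γ) ℚ./ (suc m * n*)
  1-TV≡shared {m} Γ = 1-TV≡sharedCount (letterCount Γ) (letterCount Γ*) m m* (letterCount-total Γ) (letterCount-total Γ*)

  c₁-bound : ∀ {m} (Γ : Grid k (suc m)) → c₁ w Γ ℚ.≤ (1ℚ - TV (hGrid Γ) (hGrid Γ*)) ℚ.* c₁ w Γ*
  c₁-bound {m} Γ = subst (c₁ w Γ ℚ.≤_) (sym (trans (cong (ℚ._* c₁ w Γ*) (1-TV≡shared Γ)) (/-*-/ (shared Γ) N* _ m*)))
    (/-mono-cross N (shared Γ * N*) m _ (begin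
      N * (suc m * n* * n*)       ≡⟨ rearrange N (suc m) n* ⟩
      suc m * (N * n* * n*)       ≤⟨ *-monoʳ-≤ (suc m) (dominates-shared Γ) ⟩
      suc m * (N* * shared Γ)     ≡⟨ rearrange′ (suc m) N* (shared Γ) ⟩
      shared Γ * N* * suc m       ∎))
    where
    open ≤-Reasoning
    N : ℕ
    N = appearances w Γ
    rearrange : ∀ N n n* → N * (n * n* * n*) ≡ n * (N * n* * n*)
    rearrange = solve-∀
    rearrange′ : ∀ n N* s → n * (N* * s) ≡ s * N* * n
    rearrange′ = solve-∀

  0≤1-TV : ∀ {m} (Γ : Grid k (suc m)) → ℚ.0ℚ ℚ.≤ 1ℚ - TV (hGrid Γ) (hGrid Γ*)
  0≤1-TV {m} Γ = subst (ℚ.0ℚ ℚ.≤_) (sym (1-TV≡shared Γ)) (/-mono-cross 0 (shared Γ) 0 _ z≤n)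

  extremal⇒LeScaledC₁ : ∀ {m} (Γ : Grid k (suc m)) → LeScaledC₁ w (c₁ w Γ) (1ℚ - TV (hGrid Γ) (hGrid Γ*))
  extremal⇒LeScaledC₁ Γ = (λ _ q q<c → m* , Γ* , ℚₚ.<-≤-trans q<c (c₁-bound Γ)) , λ y≤0 _ Γ′ →
    let y≡0 = ℚₚ.≤-antisym y≤0 (0≤1-TV Γ) in
    subst (λ y → c₁ w Γ ℚ.≤ y ℚ.* c₁ w Γ′) (sym y≡0)
      (subst (c₁ w Γ ℚ.≤_) (sym (ℚₚ.*-zeroˡ (c₁ w Γ′)))
        (ℚₚ.≤-trans (c₁-bound Γ) (ℚₚ.≤-reflexive (trans (cong (ℚ._* c₁ w Γ*) y≡0) (ℚₚ.*-zeroˡ (c₁ w Γ*))))))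

proposition3p2 : ∀ k (w : Word k) → HasTwoDistinctLetters w →
    Σ (Fin k → ℚ) λ hw → IsLetterDistribution hw ×
      (∀ m (Γ : Grid k (suc m)) → LeScaledC₁ w (c₁ w Γ) (1ℚ - TV (hGrid Γ) hw))
-- The hypothesis only excludes the empty word, which appears twice at every position of every grid.
proposition3p2 k []         (() , _)
proposition3p2 k (a ∷ rest) _ = hGrid Γ* , hGrid-isLetterDistribution Γ* , λ m Γ → extremal⇒LeScaledC₁ E Γ
  where
  E : ExtremalGrid (a ∷ rest)
  E = Extremal.extremal a rest
  open ExtremalGrid E
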